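{- Let $k$ be a positive integer and let $\mathcal{F}_k$ be the set of all $F_k$-overpartitions. Then \[ \sum_{\pi\in\mathcal{F}_k}z^{\ell_o(\pi)}q^{|\pi|}=1+\sum_{s=1}^k\sum_{m=1}^\infty\sum_{j=1}^mz^{j-1}\frac{q^{k\binom{j}{2}+sj+k(m-j)}}{(q;q)_{k(m-1)+s}}{m-1\brack j-1}_k+\sum_{m=1}^\infty\sum_{j=1}^mz^{j}\frac{q^{k\binom{j}{2}+km}}{(q;q)_{km}}{m-1\brack j-1}_k. \]
   Context: Here an overpartition (in the "first occurrence" convention) is a partition $\pi=(\pi_1,\ldots,\pi_\ell)$, written in non-increasing order, in which the first occurrence of each distinct part value may be overlined (so among parts of equal size the overlined one, if any, comes first). $|\pi|$ is the sum of the parts (overlined $\overline t$ counting as $t$) and $\ell_o(\pi)$ is the number of overlined parts. An $F_k$-overpartition is such an overpartition $\pi=(\pi_1,\ldots,\pi_\ell)$ with the additional property that whenever $\pi_i$ is overlined, $\ell-i\equiv -1\pmod k$. The empty overpartition is included. Notation: $(a;q)_n=\prod_{i=0}^{n-1}(1-aq^i)$; for nonnegative integers $A,B$, ${A\brack B}_k=\frac{(q^k;q^k)_A}{(q^k;q^k)_B(q^k;q^k)_{A-B}}$ if $A\ge B\ge 0$ and $0$ otherwise. -}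

module Defs where

open import Data.Bool using (Bool; true; false; _∧_; _∨_; not; if_then_else_; T)
open import Data.Nat using (ℕ; zero; suc; _+_; _*_; _∸_; _≤ᵇ_; _<ᵇ_; _≡ᵇ_)
open import Data.Nat.Divisibility using (_∣?_)
open import Data.Nat.Combinatorics using (_C_)
open import Data.Integer as ℤ using (ℤ)
open import Data.List using (List; []; _∷_; length; map; foldr; upTo)
open import Data.Bool.ListAction using (any)
open import Data.Product using (_×_; _,_; Σ)
open import Relation.Nullary.Decidable using (⌊_⌋)
open import Relation.Binary.PropositionalEquality using (_≡_)

-- Overpartitions (first-occurrence convention).
-- π = (π₁,…,π_ℓ) is a list of (part value, overlined?) in the order
-- π₁ ≥ π₂ ≥ … ≥ π_ℓ.

Part : Set
Part = ℕ × Bool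

nextOK : ℕ → List Part → Bool
nextOK a [] = true
nextOK a ((b , o) ∷ _) = (b ≤ᵇ a) ∧ (not o ∨ (b <ᵇ a))

isOverpartition : List Part → Bool
isOverpartition [] = true
isOverpartition ((a , o) ∷ rest) = (1 ≤ᵇ a) ∧ nextOK a rest ∧ isOverpartition rest

-- F_k condition: if π_i is overlined then ℓ - i ≡ -1 (mod k),
-- i.e. k ∣ ℓ - i + 1 = length of the suffix (π_i,…,π_ℓ).
fkCond : ℕ → List Part → Bool
fkCond k [] = true
fkCond k ((a , o) ∷ rest) = (not o ∨ ⌊ k ∣? suc (length rest) ⌋) ∧ fkCond k rest

isFkOverpartition : ℕ → List Part → Bool
isFkOverpartition k π = isOverpartition π ∧ fkCond k π

size : List Part → ℕ
size [] = 0
size ((a , _) ∷ rest) = a + size rest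

numOverlined : List Part → ℕ
numOverlined [] = 0
numOverlined ((_ , o) ∷ rest) = (if o then 1 else 0) + numOverlined rest

FkOver : ℕ → ℕ → ℕ → Set
FkOver k n a = Σ (List Part) λ π →
  T (isFkOverpartition k π) × size π ≡ n × numOverlined π ≡ a

-- Formal power series in q over ℤ: coefficient functions.

PS : Set
PS = ℕ → ℤ

-- finite integer sum Σ_{i=a}^{b} f i (empty if b < a)
ΣℤRange : ℕ → ℕ → (ℕ → ℤ) → ℤ
ΣℤRange a b f = foldr ℤ._+_ (ℤ.+ 0) (map (λ i → f (a + i)) (upTo (suc b ∸ a)))

onePS : PS
onePS n = if n ≡ᵇ 0 then ℤ.+ 1 else ℤ.+ 0

zeroPS : PS
zeroPS _ = ℤ.+ 0

_⊛_ : PS → PS → PS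
(f ⊛ g) n = ΣℤRange 0 n (λ i → f i ℤ.* g (n ∸ i))

infixl 7 _⊛_

shiftPS : ℕ → PS → PS
shiftPS e f n = if e ≤ᵇ n then f (n ∸ e) else ℤ.+ 0

oneMinusQ : ℕ → PS
oneMinusQ d n = (if n ≡ᵇ 0 then ℤ.+ 1 else ℤ.+ 0) ℤ.- (if n ≡ᵇ d then ℤ.+ 1 else ℤ.+ 0)

-- 1/(1 - q^d) = Σ_{t ≥ 0} q^{d t}   (used only for d ≥ 1)
geomPS : ℕ → PS
geomPS d n = if any (λ t → d * t ≡ᵇ n) (upTo (suc n)) then ℤ.+ 1 else ℤ.+ 0

prodRange : ℕ → ℕ → (ℕ → PS) → PS
prodRange a b f = foldr _⊛_ onePS (map (λ i → f (a + i)) (upTo (suc b ∸ a)))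

qPoch : ℕ → ℕ → PS
qPoch d N = prodRange 1 N (λ i → oneMinusQ (d * i))

qPochInv : ℕ → ℕ → PS
qPochInv d N = prodRange 1 N (λ i → geomPS (d * i))

qBinom : ℕ → ℕ → ℕ → PS
qBinom k A B = if B ≤ᵇ A
  then qPoch k A ⊛ qPochInv k B ⊛ qPochInv k (A ∸ B)
  else zeroPS

-- Series in z and q: PS2 z-exponent q-exponent = coefficient.

PS2 : Set
PS2 = ℕ → ℕ → ℤ

_⊞_ : PS2 → PS2 → PS2
(F ⊞ G) a n = F a n ℤ.+ G a n

infixl 6 _⊞_

zMon : ℕ → PS → PS2
zMon e f a n = if e ≡ᵇ a then f n else ℤ.+ 0

one2 : PS2
one2 = zMon 0 onePS

Σ2Range : ℕ → ℕ → (ℕ → PS2) → PS2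
Σ2Range a b F x n = ΣℤRange a b (λ i → F i x n)

term1 : ℕ → ℕ → ℕ → ℕ → PS2
term1 k s m j = zMon (j ∸ 1)
  (shiftPS (k * (j C 2) + s * j + k * (m ∸ j))
    (qPochInv 1 (k * (m ∸ 1) + s) ⊛ qBinom k (m ∸ 1) (j ∸ 1)))

term2 : ℕ → ℕ → ℕ → PS2
term2 k m j = zMon j
  (shiftPS (k * (j C 2) + k * m)
    (qPochInv 1 (k * m) ⊛ qBinom k (m ∸ 1) (j ∸ 1)))

-- right-hand side with both sums over m truncated at m ≤ M
rhsPartial : ℕ → ℕ → PS2
rhsPartial k M =
  one2
  ⊞ Σ2Range 1 k (λ s → Σ2Range 1 M (λ m → Σ2Range 1 m (λ j → term1 k s m j)))
  ⊞ Σ2Range 1 M (λ m → Σ2Range 1 m (λ j → term2 k m j))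

-- An F_k-overpartition with L parts is coded by the gaps of its parts over
-- the least values the parts below them allow, together with the set of
-- overlined positions, where a part with j parts below it may be overlined
-- only if k ∣ j + 1.  Its size is L + Σ (i + 1) xᵢ + Σ i over the overlined
-- positions i (counted from the top), so the overpartitions with L parts have
-- generating function q^L / (q;q)_L times that of the admissible markings.
-- Peeling off the top position shows that the markings of r + kM positions
-- (r < k) with a marks have generating function q^{ra + k C(a,2)} [M, a]_k,
-- a Rothe-type identity.  For L = k(m - 1) + s this is the (s, m) summand of
-- the first sum when s < k, while for s = k the q-Pascal recurrence splits it
-- into the (k, m) summand of the first sum and the m-th summand of the second.
-- Only layers with L ≤ n reach q^n, so once M ≥ n the coefficient of z^a q^n
-- counts the F_k-overpartitions of n with a overlined parts; coefficients are
-- identified with cardinalities through explicit weight-preserving bijections.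

module Submission where

open import Defs
open import Data.Nat using (ℕ; _≤_)
open import Data.Integer using (ℤ; +_)
open import Data.Fin using (Fin)
open import Data.Product using (Σ; ∃-syntax; _×_)
open import Function.Bundles using (_↔_)
open import Relation.Binary.PropositionalEquality using (_≡_)

open import Algebra.Bundles using (CommutativeSemigroup)
open import Data.Bool using (Bool; true; false; T; _∧_; if_then_else_)
open import Data.Bool.Properties using (T-∧; T-irrelevant)
open import Data.Empty using (⊥)
open import Data.Fin.Permutation using (↔⇒≡)
open import Data.Fin.Properties using (+↔⊎; *↔×; 0↔⊥; 1↔⊤)
open import Data.Integer as ℤ using (-1ℤ)
import Data.Integer.Properties as ℤₚ
import Data.Integer.Tactic.RingSolver as ℤ-Solver
open import Data.List using (List; []; _∷_; length; foldr; map; upTo; applyUpTo)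
open import Data.List.Membership.Propositional using (lose)
open import Data.List.Membership.Propositional.Properties using (∈-upTo⁺)
open import Data.List.Properties using (map-upTo)
open import Data.List.Relation.Unary.Any using (satisfied)
open import Data.List.Relation.Unary.Any.Properties using (any⁺; any⁻)
open import Data.Nat using (zero; suc; _+_; _*_; _∸_; _<_; _≤ᵇ_; _<ᵇ_; _≡ᵇ_; z≤n; s≤s; z<s; s<s)
open import Data.Nat.Combinatorics using (_C_; nCk+nC[k+1]≡[n+1]C[k+1]; nC1≡n)
open import Data.Nat.Divisibility
  using (_∣_; _∣?_; divides; _∣0; ∣-refl; ∣⇒≤; m∣m*n; ∣m∣n⇒∣m+n; ∣m+n∣m⇒∣n)
import Data.Nat.Properties as ℕₚ
import Data.Nat.Tactic.RingSolver as ℕ-Solver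
open import Data.Product using (_,_; proj₁; proj₂)
open import Data.Product.Function.NonDependent.Propositional using (_×-↔_)
open import Data.Sum using (_⊎_; inj₁; inj₂; [_,_]; [_,_]′)
open import Data.Sum.Function.Propositional using (_⊎-↔_)
open import Data.Unit using (⊤; tt)
open import Data.Vec using (Vec; []; _∷_)
open import Function using (_∘_)
open import Function.Bundles using (Inverse; Equivalence; mk↔ₛ′)
open import Function.Properties.Inverse using (↔-sym; ↔-trans)
open import Relation.Binary.Bundles using (Setoid)
open import Relation.Binary.PropositionalEquality
  using (refl; sym; trans; cong; cong₂; cong-app; subst; _≗_; _→-setoid_; module ≡-Reasoning)
import Relation.Binary.Reasoning.Setoid as SetoidReasoning
open import Relation.Nullary using (¬_; contradiction; Irrelevant)
open import Relation.Nullary.Decidable using (yes; no; ⌊_⌋; fromWitness; toWitness)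

open import Algebra.Properties.CommutativeSemigroup ℤₚ.+-commutativeSemigroup
  using () renaming (interchange to +-interchange; x∙yz≈y∙xz to x+yz≡y+xz)

if-T : ∀ {A : Set} {b} {x y : A} → T b → (if b then x else y) ≡ x
if-T {b = true} _ = refl

if-¬T : ∀ {A : Set} {b} {x y : A} → ¬ T b → (if b then x else y) ≡ y
if-¬T {b = false} _  = refl
if-¬T {b = true}  ¬t = contradiction _ ¬t

T-∧⁻ : ∀ x {y} → T (x ∧ y) → T x × T y
T-∧⁻ x = Equivalence.to (T-∧ {x})

T-∧⁺ : ∀ {x y} → T x → T y → T (x ∧ y)
T-∧⁺ {x} tx ty = Equivalence.from (T-∧ {x}) (tx , ty)

σ : ℕ → (ℕ → ℤ) → ℤ
σ N f = foldr ℤ._+_ (+ 0) (applyUpTo f N)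

ΣℤRange≡σ : ∀ a b f → ΣℤRange a b f ≡ σ (suc b ∸ a) (λ i → f (a + i))
ΣℤRange≡σ a b f = cong (foldr ℤ._+_ (+ 0)) (map-upTo (λ i → f (a + i)) (suc b ∸ a))

σ-cong : ∀ N {f g : ℕ → ℤ} → (∀ {i} → i < N → f i ≡ g i) → σ N f ≡ σ N g
σ-cong zero    f≡g = refl
σ-cong (suc N) f≡g = cong₂ ℤ._+_ (f≡g z<s) (σ-cong N (f≡g ∘ s<s))

σ-cong-≗ : ∀ N {f g : ℕ → ℤ} → f ≗ g → σ N f ≡ σ N g
σ-cong-≗ N f≗g = σ-cong N (λ {i} _ → f≗g i)

σ-zero : ∀ N {f : ℕ → ℤ} → (∀ i → f i ≡ + 0) → σ N f ≡ + 0
σ-zero zero    f≡0 = refl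
σ-zero (suc N) f≡0 = cong₂ ℤ._+_ (f≡0 0) (σ-zero N (f≡0 ∘ suc))

σ-distrib-+ : ∀ N (f g : ℕ → ℤ) → σ N (λ i → f i ℤ.+ g i) ≡ σ N f ℤ.+ σ N g
σ-distrib-+ zero    f g = refl
σ-distrib-+ (suc N) f g = begin
  (f 0 ℤ.+ g 0) ℤ.+ σ N (λ i → f (suc i) ℤ.+ g (suc i))
    ≡⟨ cong (ℤ._+_ (f 0 ℤ.+ g 0)) (σ-distrib-+ N (f ∘ suc) (g ∘ suc)) ⟩
  (f 0 ℤ.+ g 0) ℤ.+ (σ N (f ∘ suc) ℤ.+ σ N (g ∘ suc))
    ≡⟨ +-interchange (f 0) (g 0) (σ N (f ∘ suc)) (σ N (g ∘ suc)) ⟩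
  (f 0 ℤ.+ σ N (f ∘ suc)) ℤ.+ (g 0 ℤ.+ σ N (g ∘ suc)) ∎
  where open ≡-Reasoning

σ-comm : ∀ M N (F : ℕ → ℕ → ℤ) → σ M (λ i → σ N (F i)) ≡ σ N (λ j → σ M (λ i → F i j))
σ-comm zero    N F = sym (σ-zero N (λ _ → refl))
σ-comm (suc M) N F = trans (cong (ℤ._+_ (σ N (F 0))) (σ-comm M N (F ∘ suc)))
                           (sym (σ-distrib-+ N (F 0) (λ j → σ M (λ i → F (suc i) j))))

σ-last : ∀ N (f : ℕ → ℤ) → σ (suc N) f ≡ σ N f ℤ.+ f N
σ-last zero    f = trans (ℤₚ.+-identityʳ (f 0)) (sym (ℤₚ.+-identityˡ (f 0)))
σ-last (suc N) f = trans (cong (ℤ._+_ (f 0)) (σ-last N (f ∘ suc))) (sym (ℤₚ.+-assoc (f 0) _ _))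

σ-+ : ∀ m n (f : ℕ → ℤ) → σ (m + n) f ≡ σ m f ℤ.+ σ n (λ i → f (m + i))
σ-+ zero    n f = sym (ℤₚ.+-identityˡ _)
σ-+ (suc m) n f = trans (cong (ℤ._+_ (f 0)) (σ-+ m n (f ∘ suc))) (sym (ℤₚ.+-assoc (f 0) _ _))

σ-* : ∀ k M (f : ℕ → ℤ) → σ (k * M) f ≡ σ M (λ m → σ k (λ s → f (s + k * m)))
σ-* k zero    f = cong (λ N → σ N f) (ℕₚ.*-zeroʳ k)
σ-* k (suc M) f = begin
  σ (k * suc M) f                                         ≡⟨ cong (λ N → σ N f) (ℕₚ.*-suc k M) ⟩
  σ (k + k * M) f                                         ≡⟨ σ-+ k (k * M) f ⟩
  σ k f ℤ.+ σ (k * M) (λ i → f (k + i))                   ≡⟨ cong₂ ℤ._+_ (σ-cong-≗ k first) (σ-* k M _) ⟩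
  σ k (λ s → f (s + k * 0)) ℤ.+ σ M (λ m → σ k (λ s → f (k + (s + k * m))))
    ≡⟨ cong (ℤ._+_ (σ k (λ s → f (s + k * 0))))
         (σ-cong-≗ M (λ m → σ-cong-≗ k (λ s → cong f (rest s m)))) ⟩
  σ (suc M) (λ m → σ k (λ s → f (s + k * m)))             ∎
  where
  open ≡-Reasoning
  first : ∀ s → f s ≡ f (s + k * 0)
  first s = cong f (sym (trans (cong (_+_ s) (ℕₚ.*-zeroʳ k)) (ℕₚ.+-identityʳ s)))
  rest : ∀ s m → k + (s + k * m) ≡ s + k * suc m
  rest s m = trans (ℕₚ.+-comm k _) (trans (ℕₚ.+-assoc s _ k)
               (cong (_+_ s) (trans (ℕₚ.+-comm (k * m) k) (sym (ℕₚ.*-suc k m)))))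

σ-select : ∀ N {a} (h : ℕ → ℤ) → a < N → σ N (λ i → if i ≡ᵇ a then h i else + 0) ≡ h a
σ-select (suc N) {zero}  h _         = trans (cong (ℤ._+_ (h 0)) (σ-zero N (λ _ → refl))) (ℤₚ.+-identityʳ _)
σ-select (suc N) {suc a} h (s<s a<N) = trans (ℤₚ.+-identityˡ _) (σ-select N (h ∘ suc) a<N)

σ-select-none : ∀ N {a} (h : ℕ → ℤ) → N ≤ a → σ N (λ i → if i ≡ᵇ a then h i else + 0) ≡ + 0
σ-select-none zero    h _         = refl
σ-select-none (suc N) {suc a} h (s≤s N≤a) = trans (ℤₚ.+-identityˡ _) (σ-select-none N (h ∘ suc) N≤a)

module ≗-Reasoning = SetoidReasoning (ℕ →-setoid ℤ)

infixl 6 _⊕_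
infixr 7 _·_
infixl 7 _∙_

_⊕_ : PS → PS → PS
(f ⊕ g) n = f n ℤ.+ g n

_·_ : ℤ → PS → PS
(c · f) n = c ℤ.* f n

_∙_ : PS → PS → PS
(f ∙ g) zero    = f 0 ℤ.* g 0
(f ∙ g) (suc n) = f 0 ℤ.* g (suc n) ℤ.+ ((f ∘ suc) ∙ g) n

∙-σ : ∀ f g n → (f ∙ g) n ≡ σ (suc n) (λ i → f i ℤ.* g (n ∸ i))
∙-σ f g zero    = sym (ℤₚ.+-identityʳ _)
∙-σ f g (suc n) = cong (ℤ._+_ (f 0 ℤ.* g (suc n))) (∙-σ (f ∘ suc) g n)

⊛≗∙ : ∀ f g → f ⊛ g ≗ f ∙ g
⊛≗∙ f g n = trans (ΣℤRange≡σ 0 n (λ i → f i ℤ.* g (n ∸ i))) (sym (∙-σ f g n))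

⊕-cong : ∀ {f f′ g g′} → f ≗ f′ → g ≗ g′ → f ⊕ g ≗ f′ ⊕ g′
⊕-cong f≗f′ g≗g′ n = cong₂ ℤ._+_ (f≗f′ n) (g≗g′ n)

⊕-identityʳ : ∀ f → f ⊕ zeroPS ≗ f
⊕-identityʳ f n = ℤₚ.+-identityʳ (f n)

∙-cong : ∀ {f f′ g g′} → f ≗ f′ → g ≗ g′ → f ∙ g ≗ f′ ∙ g′
∙-cong f≗f′ g≗g′ zero    = cong₂ ℤ._*_ (f≗f′ 0) (g≗g′ 0)
∙-cong f≗f′ g≗g′ (suc n) =
  cong₂ ℤ._+_ (cong₂ ℤ._*_ (f≗f′ 0) (g≗g′ (suc n))) (∙-cong (f≗f′ ∘ suc) g≗g′ n)

∙-congˡ : ∀ f {g g′} → g ≗ g′ → f ∙ g ≗ f ∙ g′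
∙-congˡ f = ∙-cong {f} (λ _ → refl)

∙-congʳ : ∀ {f f′} g → f ≗ f′ → f ∙ g ≗ f′ ∙ g
∙-congʳ g f≗f′ = ∙-cong f≗f′ (λ _ → refl)

∙-distribʳ-⊕ : ∀ f g h → (f ⊕ g) ∙ h ≗ f ∙ h ⊕ g ∙ h
∙-distribʳ-⊕ f g h zero    = ℤₚ.*-distribʳ-+ (h 0) (f 0) (g 0)
∙-distribʳ-⊕ f g h (suc n) = trans
  (cong₂ ℤ._+_ (ℤₚ.*-distribʳ-+ (h (suc n)) (f 0) (g 0)) (∙-distribʳ-⊕ (f ∘ suc) (g ∘ suc) h n))
  (+-interchange (f 0 ℤ.* h (suc n)) (g 0 ℤ.* h (suc n)) (((f ∘ suc) ∙ h) n) (((g ∘ suc) ∙ h) n))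

·-∙ : ∀ c f g → (c · f) ∙ g ≗ c · (f ∙ g)
·-∙ c f g zero    = ℤₚ.*-assoc c (f 0) (g 0)
·-∙ c f g (suc n) = trans (cong₂ ℤ._+_ (ℤₚ.*-assoc c (f 0) (g (suc n))) (·-∙ c (f ∘ suc) g n))
                          (sym (ℤₚ.*-distribˡ-+ c _ _))

∙-unfoldʳ : ∀ f g n → (f ∙ g) (suc n) ≡ g 0 ℤ.* f (suc n) ℤ.+ (f ∙ (g ∘ suc)) n
∙-unfoldʳ f g zero    = swap (f 0) (f 1) (g 0) (g 1)
  where
  swap : ∀ a b c d → a ℤ.* d ℤ.+ b ℤ.* c ≡ c ℤ.* b ℤ.+ a ℤ.* d
  swap = ℤ-Solver.solve-∀
∙-unfoldʳ f g (suc n) = begin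
  f 0 ℤ.* g (suc (suc n)) ℤ.+ ((f ∘ suc) ∙ g) (suc n)
    ≡⟨ cong (ℤ._+_ (f 0 ℤ.* g (suc (suc n)))) (∙-unfoldʳ (f ∘ suc) g n) ⟩
  f 0 ℤ.* g (suc (suc n)) ℤ.+ (g 0 ℤ.* f (suc (suc n)) ℤ.+ ((f ∘ suc) ∙ (g ∘ suc)) n)
    ≡⟨ x+yz≡y+xz (f 0 ℤ.* g (suc (suc n))) (g 0 ℤ.* f (suc (suc n))) (((f ∘ suc) ∙ (g ∘ suc)) n) ⟩
  g 0 ℤ.* f (suc (suc n)) ℤ.+ (f 0 ℤ.* g (suc (suc n)) ℤ.+ ((f ∘ suc) ∙ (g ∘ suc)) n) ∎
  where open ≡-Reasoning

∙-comm : ∀ f g → f ∙ g ≗ g ∙ f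
∙-comm f g zero    = ℤₚ.*-comm (f 0) (g 0)
∙-comm f g (suc n) = trans (∙-unfoldʳ f g n) (cong (ℤ._+_ (g 0 ℤ.* f (suc n))) (∙-comm f (g ∘ suc) n))

∙-distribˡ-⊕ : ∀ f g h → f ∙ (g ⊕ h) ≗ f ∙ g ⊕ f ∙ h
∙-distribˡ-⊕ f g h = begin
  f ∙ (g ⊕ h)     ≈⟨ ∙-comm f (g ⊕ h) ⟩
  (g ⊕ h) ∙ f     ≈⟨ ∙-distribʳ-⊕ g h f ⟩
  g ∙ f ⊕ h ∙ f   ≈⟨ ⊕-cong (∙-comm g f) (∙-comm h f) ⟩
  f ∙ g ⊕ f ∙ h   ∎
  where open ≗-Reasoning

∙-assoc : ∀ f g h → (f ∙ g) ∙ h ≗ f ∙ (g ∙ h)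
∙-assoc f g h zero    = ℤₚ.*-assoc (f 0) (g 0) (h 0)
∙-assoc f g h (suc n) = begin
  (f 0 ℤ.* g 0) ℤ.* h (suc n) ℤ.+ ((f 0 · (g ∘ suc) ⊕ (f ∘ suc) ∙ g) ∙ h) n
    ≡⟨ cong (ℤ._+_ ((f 0 ℤ.* g 0) ℤ.* h (suc n)))
         (trans (∙-distribʳ-⊕ (f 0 · (g ∘ suc)) ((f ∘ suc) ∙ g) h n)
                (cong₂ ℤ._+_ (·-∙ (f 0) (g ∘ suc) h n) (∙-assoc (f ∘ suc) g h n))) ⟩
  (f 0 ℤ.* g 0) ℤ.* h (suc n) ℤ.+ (f 0 ℤ.* ((g ∘ suc) ∙ h) n ℤ.+ ((f ∘ suc) ∙ (g ∙ h)) n)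
    ≡⟨ regroup (f 0) (g 0) (h (suc n)) (((g ∘ suc) ∙ h) n) (((f ∘ suc) ∙ (g ∙ h)) n) ⟩
  f 0 ℤ.* (g 0 ℤ.* h (suc n) ℤ.+ ((g ∘ suc) ∙ h) n) ℤ.+ ((f ∘ suc) ∙ (g ∙ h)) n ∎
  where
  open ≡-Reasoning
  regroup : ∀ a b c d e → (a ℤ.* b) ℤ.* c ℤ.+ (a ℤ.* d ℤ.+ e) ≡ a ℤ.* (b ℤ.* c ℤ.+ d) ℤ.+ e
  regroup = ℤ-Solver.solve-∀

∙-zeroˡ : ∀ f → zeroPS ∙ f ≗ zeroPS
∙-zeroˡ f zero    = refl
∙-zeroˡ f (suc n) = trans (ℤₚ.+-identityˡ _) (∙-zeroˡ f n)

∙-zeroʳ : ∀ f → f ∙ zeroPS ≗ zeroPS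
∙-zeroʳ f n = trans (∙-comm f zeroPS n) (∙-zeroˡ f n)

∙-identityˡ : ∀ f → onePS ∙ f ≗ f
∙-identityˡ f zero    = ℤₚ.*-identityˡ (f 0)
∙-identityˡ f (suc n) = trans (cong₂ ℤ._+_ (ℤₚ.*-identityˡ (f (suc n))) (∙-zeroˡ f n)) (ℤₚ.+-identityʳ _)

∙-identityʳ : ∀ f → f ∙ onePS ≗ f
∙-identityʳ f n = trans (∙-comm f onePS n) (∙-identityˡ f n)

∙-commutativeSemigroup : CommutativeSemigroup _ _
∙-commutativeSemigroup = record
  { Carrier = PS
  ; _≈_     = _≗_
  ; _∙_     = _∙_
  ; isCommutativeSemigroup = record
    { isSemigroup = record
      { isMagma = record
        { isEquivalence = Setoid.isEquivalence (ℕ →-setoid ℤ)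
        ; ∙-cong        = ∙-cong
        }
      ; assoc = ∙-assoc
      }
    ; comm = ∙-comm
    }
  }

open import Algebra.Properties.CommutativeSemigroup ∙-commutativeSemigroup
  using (interchange; xy∙z≈xz∙y)

shift : ℕ → PS → PS
shift zero    f n       = f n
shift (suc e) f zero    = + 0
shift (suc e) f (suc n) = shift e f n

shiftPS≗shift : ∀ e f → shiftPS e f ≗ shift e f
shiftPS≗shift zero    f n       = refl
shiftPS≗shift (suc e) f zero    = refl
shiftPS≗shift (suc e) f (suc n) =
  trans (cong (λ b → if b then f (n ∸ e) else + 0) (<ᵇ-suc e n)) (shiftPS≗shift e f n)
  where
  <ᵇ-suc : ∀ e n → (e <ᵇ suc n) ≡ (e ≤ᵇ n)
  <ᵇ-suc zero    n = refl
  <ᵇ-suc (suc e) n = refl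

shift-≡ : ∀ {d e} f → d ≡ e → shift d f ≗ shift e f
shift-≡ f refl n = refl

shift-cong : ∀ e {f g} → f ≗ g → shift e f ≗ shift e g
shift-cong zero    f≗g n       = f≗g n
shift-cong (suc e) f≗g zero    = refl
shift-cong (suc e) f≗g (suc n) = shift-cong e f≗g n

shift-+ : ∀ d e f → shift d (shift e f) ≗ shift (d + e) f
shift-+ zero    e f n       = refl
shift-+ (suc d) e f zero    = refl
shift-+ (suc d) e f (suc n) = shift-+ d e f n

shift-⊕ : ∀ e f g → shift e (f ⊕ g) ≗ shift e f ⊕ shift e g
shift-⊕ zero    f g n       = refl
shift-⊕ (suc e) f g zero    = refl
shift-⊕ (suc e) f g (suc n) = shift-⊕ e f g n

shift-· : ∀ e c f → shift e (c · f) ≗ c · shift e f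
shift-· zero    c f n       = refl
shift-· (suc e) c f zero    = sym (ℤₚ.*-zeroʳ c)
shift-· (suc e) c f (suc n) = shift-· e c f n

shift-zeroPS : ∀ e → shift e zeroPS ≗ zeroPS
shift-zeroPS zero    n       = refl
shift-zeroPS (suc e) zero    = refl
shift-zeroPS (suc e) (suc n) = shift-zeroPS e n

shift-∙ : ∀ e f g → shift e f ∙ g ≗ shift e (f ∙ g)
shift-∙ zero    f g n       = refl
shift-∙ (suc e) f g zero    = refl
shift-∙ (suc e) f g (suc n) = trans (ℤₚ.+-identityˡ _) (shift-∙ e f g n)

∙-shift : ∀ e f g → f ∙ shift e g ≗ shift e (f ∙ g)
∙-shift e f g = begin
  f ∙ shift e g    ≈⟨ ∙-comm f (shift e g) ⟩
  shift e g ∙ f    ≈⟨ shift-∙ e g f ⟩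
  shift e (g ∙ f)  ≈⟨ shift-cong e (∙-comm g f) ⟩
  shift e (f ∙ g)  ∎
  where open ≗-Reasoning

shift-< : ∀ {e n} f → n < e → shift e f n ≡ + 0
shift-< {suc e} {zero}  f _         = refl
shift-< {suc e} {suc n} f (s<s n<e) = shift-< f n<e

shift-+ₙ : ∀ e m f → shift e f (e + m) ≡ f m
shift-+ₙ zero    m f = refl
shift-+ₙ (suc e) m f = shift-+ₙ e m f

shift-onePS : ∀ e n → shift e onePS n ≡ (if n ≡ᵇ e then + 1 else + 0)
shift-onePS zero    n       = refl
shift-onePS (suc e) zero    = refl
shift-onePS (suc e) (suc n) = shift-onePS e n

∏ : ℕ → (ℕ → PS) → PS
∏ N f = foldr _∙_ onePS (applyUpTo f N)

prodRange≗∏ : ∀ a b f → prodRange a b f ≗ ∏ (suc b ∸ a) (λ i → f (a + i))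
prodRange≗∏ a b f n = trans (foldr-⊛≗∏ (map (λ i → f (a + i)) (upTo (suc b ∸ a))) n)
                            (cong (λ fs → foldr _∙_ onePS fs n) (map-upTo (λ i → f (a + i)) (suc b ∸ a)))
  where
  foldr-⊛≗∏ : ∀ fs → foldr _⊛_ onePS fs ≗ foldr _∙_ onePS fs
  foldr-⊛≗∏ []       n = refl
  foldr-⊛≗∏ (f ∷ fs) n = trans (⊛≗∙ f _ n) (∙-congˡ f (foldr-⊛≗∏ fs) n)

∏-cong : ∀ N {f g} → (∀ i → f i ≗ g i) → ∏ N f ≗ ∏ N g
∏-cong zero    f≗g = λ _ → refl
∏-cong (suc N) f≗g = ∙-cong (f≗g 0) (∏-cong N (f≗g ∘ suc))

∏-onePS : ∀ N {f} → (∀ i → f i ≗ onePS) → ∏ N f ≗ onePS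
∏-onePS zero    f≗1 = λ _ → refl
∏-onePS (suc N) f≗1 n = trans (∙-cong (f≗1 0) (∏-onePS N (f≗1 ∘ suc)) n) (∙-identityˡ onePS n)

∏-∙ : ∀ N f g → ∏ N f ∙ ∏ N g ≗ ∏ N (λ i → f i ∙ g i)
∏-∙ zero    f g = ∙-identityˡ onePS
∏-∙ (suc N) f g = begin
  (f 0 ∙ ∏ N (f ∘ suc)) ∙ (g 0 ∙ ∏ N (g ∘ suc))  ≈⟨ interchange (f 0) _ (g 0) _ ⟩
  (f 0 ∙ g 0) ∙ (∏ N (f ∘ suc) ∙ ∏ N (g ∘ suc))
    ≈⟨ ∙-congˡ (f 0 ∙ g 0) (∏-∙ N (f ∘ suc) (g ∘ suc)) ⟩
  (f 0 ∙ g 0) ∙ ∏ N (λ i → f (suc i) ∙ g (suc i)) ∎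
  where open ≗-Reasoning

∏-snoc : ∀ N f → ∏ (suc N) f ≗ ∏ N f ∙ f N
∏-snoc zero    f = ∙-comm (f 0) onePS
∏-snoc (suc N) f = begin
  f 0 ∙ ∏ (suc N) (f ∘ suc)      ≈⟨ ∙-congˡ (f 0) (∏-snoc N (f ∘ suc)) ⟩
  f 0 ∙ (∏ N (f ∘ suc) ∙ f (suc N)) ≈⟨ ∙-assoc (f 0) _ _ ⟨
  f 0 ∙ ∏ N (f ∘ suc) ∙ f (suc N) ∎
  where open ≗-Reasoning

geomPS-∣ : ∀ e n → suc e ∣ n → geomPS (suc e) n ≡ + 1
geomPS-∣ e n (divides t n≡td) =
  if-T (any⁺ (λ t → suc e * t ≡ᵇ n) (lose (∈-upTo⁺ (s≤s t≤n)) (ℕₚ.≡⇒≡ᵇ _ _ dt≡n)))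
  where
  dt≡n : suc e * t ≡ n
  dt≡n = trans (ℕₚ.*-comm (suc e) t) (sym n≡td)
  t≤n : t ≤ n
  t≤n = subst (t ≤_) (sym n≡td) (ℕₚ.m≤m*n t (suc e))

geomPS-∤ : ∀ e n → ¬ suc e ∣ n → geomPS (suc e) n ≡ + 0
geomPS-∤ e n ∤n = if-¬T λ any-true →
  let t , dt≡n = satisfied (any⁻ (λ t → suc e * t ≡ᵇ n) (upTo (suc n)) any-true)
  in ∤n (divides t (trans (sym (ℕₚ.≡ᵇ⇒≡ _ _ dt≡n)) (ℕₚ.*-comm (suc e) t)))

geomPS-periodic : ∀ e m → geomPS (suc e) (suc e + m) ≡ geomPS (suc e) m
geomPS-periodic e m with suc e ∣? m
... | yes d∣m = trans (geomPS-∣ e _ (∣m∣n⇒∣m+n ∣-refl d∣m)) (sym (geomPS-∣ e m d∣m))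
... | no  d∤m =
  trans (geomPS-∤ e _ (λ d∣d+m → d∤m (∣m+n∣m⇒∣n d∣d+m ∣-refl))) (sym (geomPS-∤ e m d∤m))

oneMinusQ≗ : ∀ d → oneMinusQ d ≗ onePS ⊕ -1ℤ · shift d onePS
oneMinusQ≗ d n = cong (ℤ._+_ (onePS n))
  (trans (sym (ℤₚ.-1*i≡-i _)) (cong (ℤ._*_ -1ℤ) (sym (shift-onePS d n))))

oneMinusQ∙ : ∀ d g → oneMinusQ d ∙ g ≗ g ⊕ -1ℤ · shift d g
oneMinusQ∙ d g = begin
  oneMinusQ d ∙ g                                ≈⟨ ∙-congʳ g (oneMinusQ≗ d) ⟩
  (onePS ⊕ -1ℤ · shift d onePS) ∙ g              ≈⟨ ∙-distribʳ-⊕ onePS _ g ⟩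
  onePS ∙ g ⊕ (-1ℤ · shift d onePS) ∙ g          ≈⟨ ⊕-cong (∙-identityˡ g) (·-∙ -1ℤ _ g) ⟩
  g ⊕ -1ℤ · (shift d onePS ∙ g)                  ≈⟨ ⊕-cong {g} (λ _ → refl) (λ n → cong (ℤ._*_ -1ℤ)
                                                      (trans (shift-∙ d onePS g n) (shift-cong d (∙-identityˡ g) n))) ⟩
  g ⊕ -1ℤ · shift d g                            ∎
  where open ≗-Reasoning

oneMinusQ∙geomPS : ∀ e → oneMinusQ (suc e) ∙ geomPS (suc e) ≗ onePS
oneMinusQ∙geomPS e n = trans (oneMinusQ∙ d G n) (cancel n)
  where
  d = suc e
  G = geomPS d
  cancel : ∀ n → G n ℤ.+ -1ℤ ℤ.* shift d G n ≡ onePS n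
  cancel n with ℕₚ.<-≤-connex n d
  ... | inj₁ n<d =
    trans (cong (λ x → G n ℤ.+ -1ℤ ℤ.* x) (shift-< G n<d)) (trans (ℤₚ.+-identityʳ _) (below n n<d))
    where
    below : ∀ n → n < d → G n ≡ onePS n
    below zero    _   = geomPS-∣ e 0 (d ∣0)
    below (suc n) n<d = geomPS-∤ e (suc n) (λ d∣n → ℕₚ.<⇒≱ n<d (∣⇒≤ d∣n))
  ... | inj₂ d≤n =
    subst (λ n → G n ℤ.+ -1ℤ ℤ.* shift d G n ≡ onePS n) (ℕₚ.m+[n∸m]≡n d≤n) (above (n ∸ d))
    where
    above : ∀ m → G (d + m) ℤ.+ -1ℤ ℤ.* shift d G (d + m) ≡ + 0
    above m = trans (cong₂ (λ x y → x ℤ.+ -1ℤ ℤ.* y) (geomPS-periodic e m) (shift-+ₙ d m G))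
                    (trans (cong (ℤ._+_ (G m)) (ℤₚ.-1*i≡-i (G m))) (ℤₚ.+-inverseʳ (G m)))

qPoch≗∏ : ∀ d N → qPoch d N ≗ ∏ N (λ i → oneMinusQ (d * suc i))
qPoch≗∏ d N = prodRange≗∏ 1 N (λ i → oneMinusQ (d * i))

qPochInv≗∏ : ∀ d N → qPochInv d N ≗ ∏ N (λ i → geomPS (d * suc i))
qPochInv≗∏ d N = prodRange≗∏ 1 N (λ i → geomPS (d * i))

qPoch-suc : ∀ d N → qPoch d (suc N) ≗ qPoch d N ∙ oneMinusQ (d * suc N)
qPoch-suc d N = begin
  qPoch d (suc N)                                        ≈⟨ qPoch≗∏ d (suc N) ⟩
  ∏ (suc N) (λ i → oneMinusQ (d * suc i))                ≈⟨ ∏-snoc N _ ⟩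
  ∏ N (λ i → oneMinusQ (d * suc i)) ∙ oneMinusQ (d * suc N) ≈⟨ ∙-congʳ _ (qPoch≗∏ d N) ⟨
  qPoch d N ∙ oneMinusQ (d * suc N)                      ∎
  where open ≗-Reasoning

qPoch∙qPochInv : ∀ k N → qPoch (suc k) N ∙ qPochInv (suc k) N ≗ onePS
qPoch∙qPochInv k N = begin
  qPoch (suc k) N ∙ qPochInv (suc k) N     ≈⟨ ∙-cong (qPoch≗∏ (suc k) N) (qPochInv≗∏ (suc k) N) ⟩
  ∏ N _ ∙ ∏ N _                            ≈⟨ ∏-∙ N _ _ ⟩
  ∏ N (λ i → oneMinusQ (suc k * suc i) ∙ geomPS (suc k * suc i))
    ≈⟨ ∏-onePS N (λ i → oneMinusQ∙geomPS (i + k * suc i)) ⟩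
  onePS                                    ∎
  where open ≗-Reasoning

-- Gaussian polynomials

gauss : ℕ → ℕ → ℕ → PS
gauss k A       zero    = onePS
gauss k zero    (suc B) = zeroPS
gauss k (suc A) (suc B) = gauss k A B ⊕ shift (k * suc B) (gauss k A (suc B))

gauss-vanishes : ∀ k {A B} → A < B → gauss k A B ≗ zeroPS
gauss-vanishes k {zero}  {suc B} _         n = refl
gauss-vanishes k {suc A} {suc B} (s<s A<B) n = cong₂ ℤ._+_ (gauss-vanishes k A<B n)
  (trans (shift-cong (k * suc B) (gauss-vanishes k (ℕₚ.m<n⇒m<1+n A<B)) n) (shift-zeroPS (k * suc B) n))

shift-gauss-pascal : ∀ k M b c →
  shift (k * suc b + c) (gauss k M (suc b)) ⊕ shift c (gauss k M b) ≗ shift c (gauss k (suc M) (suc b))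
shift-gauss-pascal k M b c n = begin
  shift (e + c) G₁ n ℤ.+ shift c G₀ n       ≡⟨ ℤₚ.+-comm (shift (e + c) G₁ n) (shift c G₀ n) ⟩
  shift c G₀ n ℤ.+ shift (e + c) G₁ n       ≡⟨ cong (ℤ._+_ (shift c G₀ n)) (shift-≡ G₁ (ℕₚ.+-comm e c) n) ⟩
  shift c G₀ n ℤ.+ shift (c + e) G₁ n       ≡⟨ cong (ℤ._+_ (shift c G₀ n)) (shift-+ c e G₁ n) ⟨
  shift c G₀ n ℤ.+ shift c (shift e G₁) n   ≡⟨ shift-⊕ c G₀ (shift e G₁) n ⟨
  shift c (gauss k (suc M) (suc b)) n       ∎
  where
  open ≡-Reasoning
  e  = k * suc b
  G₀ = gauss k M b
  G₁ = gauss k M (suc b)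

oneMinusQ-zero : oneMinusQ 0 ≗ zeroPS
oneMinusQ-zero n = ℤₚ.+-inverseʳ (onePS n)

oneMinusQ-+ : ∀ d e → oneMinusQ d ⊕ shift d (oneMinusQ e) ≗ oneMinusQ (d + e)
oneMinusQ-+ d e n = begin
  oneMinusQ d n ℤ.+ shift d (oneMinusQ e) n
    ≡⟨ cong₂ ℤ._+_ (oneMinusQ≗ d n) (trans (shift-cong d (oneMinusQ≗ e) n) (shift-⊕ d _ _ n)) ⟩
  (onePS n ℤ.+ -1ℤ ℤ.* shift d onePS n) ℤ.+ (shift d onePS n ℤ.+ shift d (-1ℤ · shift e onePS) n)
    ≡⟨ cong (ℤ._+_ (onePS n ℤ.+ -1ℤ ℤ.* shift d onePS n)) (cong (ℤ._+_ (shift d onePS n))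
         (trans (shift-· d -1ℤ _ n) (cong (ℤ._*_ -1ℤ) (shift-+ d e onePS n)))) ⟩
  (onePS n ℤ.+ -1ℤ ℤ.* shift d onePS n) ℤ.+ (shift d onePS n ℤ.+ -1ℤ ℤ.* shift (d + e) onePS n)
    ≡⟨ telescope (onePS n) (shift d onePS n) (shift (d + e) onePS n) ⟩
  onePS n ℤ.+ -1ℤ ℤ.* shift (d + e) onePS n
    ≡⟨ oneMinusQ≗ (d + e) n ⟨
  oneMinusQ (d + e) n ∎
  where
  open ≡-Reasoning
  telescope : ∀ a b c → (a ℤ.+ -1ℤ ℤ.* b) ℤ.+ (b ℤ.+ -1ℤ ℤ.* c) ≡ a ℤ.+ -1ℤ ℤ.* c
  telescope = ℤ-Solver.solve-∀

GaussPoch : ℕ → ℕ → Set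
GaussPoch k A = ∀ B D → B + D ≡ A → gauss k A B ∙ qPoch k B ∙ qPoch k D ≗ qPoch k A

gaussPoch-zero : ∀ k A D → A ≡ D → gauss k A 0 ∙ qPoch k 0 ∙ qPoch k D ≗ qPoch k A
gaussPoch-zero k A D refl = begin
  onePS ∙ onePS ∙ qPoch k A  ≈⟨ ∙-congʳ (qPoch k A) (∙-identityˡ onePS) ⟩
  onePS ∙ qPoch k A          ≈⟨ ∙-identityˡ (qPoch k A) ⟩
  qPoch k A                  ∎
  where open ≗-Reasoning

gaussPoch-low : ∀ k {A} → GaussPoch k A → ∀ B D → B + D ≡ A →
  gauss k A B ∙ qPoch k (suc B) ∙ qPoch k D ≗ qPoch k A ∙ oneMinusQ (k * suc B)
gaussPoch-low k {A} ih B D B+D≡A = begin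
  G ∙ qPoch k (suc B) ∙ qPoch k D          ≈⟨ ∙-congʳ (qPoch k D) (∙-congˡ G (qPoch-suc k B)) ⟩
  G ∙ (qPoch k B ∙ oneMinusQ e) ∙ qPoch k D ≈⟨ ∙-congʳ (qPoch k D) (∙-assoc G _ _) ⟨
  G ∙ qPoch k B ∙ oneMinusQ e ∙ qPoch k D  ≈⟨ xy∙z≈xz∙y _ _ _ ⟩
  G ∙ qPoch k B ∙ qPoch k D ∙ oneMinusQ e  ≈⟨ ∙-congʳ (oneMinusQ e) (ih B D B+D≡A) ⟩
  qPoch k A ∙ oneMinusQ e                  ∎
  where
  open ≗-Reasoning
  G = gauss k A B
  e = k * suc B

gaussPoch-high : ∀ k {A} → GaussPoch k A → ∀ B D → suc B + D ≡ suc A →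
  gauss k A (suc B) ∙ qPoch k (suc B) ∙ qPoch k D ≗ qPoch k A ∙ oneMinusQ (k * D)
gaussPoch-high k {A} ih B zero eq = begin
  G ∙ qPoch k (suc B) ∙ onePS  ≈⟨ ∙-congʳ onePS (∙-congʳ (qPoch k (suc B)) (gauss-vanishes k A<1+B)) ⟩
  zeroPS ∙ qPoch k (suc B) ∙ onePS ≈⟨ ∙-congʳ onePS (∙-zeroˡ (qPoch k (suc B))) ⟩
  zeroPS ∙ onePS               ≈⟨ ∙-zeroˡ onePS ⟩
  zeroPS                       ≈⟨ ∙-zeroʳ (qPoch k A) ⟨
  qPoch k A ∙ zeroPS           ≈⟨ ∙-congˡ (qPoch k A) oneMinusQ-k*0 ⟨
  qPoch k A ∙ oneMinusQ (k * 0) ∎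
  where
  open ≗-Reasoning
  G = gauss k A (suc B)
  A<1+B : A < suc B
  A<1+B = ℕₚ.≤-reflexive (sym (trans (sym (ℕₚ.+-identityʳ (suc B))) eq))
  oneMinusQ-k*0 : oneMinusQ (k * 0) ≗ zeroPS
  oneMinusQ-k*0 n = trans (cong (λ d → oneMinusQ d n) (ℕₚ.*-zeroʳ k)) (oneMinusQ-zero n)
gaussPoch-high k {A} ih B (suc D) eq = begin
  G ∙ qPoch k (suc B) ∙ qPoch k (suc D)                ≈⟨ ∙-congˡ (G ∙ qPoch k (suc B)) (qPoch-suc k D) ⟩
  G ∙ qPoch k (suc B) ∙ (qPoch k D ∙ oneMinusQ e)      ≈⟨ ∙-assoc _ _ _ ⟨
  G ∙ qPoch k (suc B) ∙ qPoch k D ∙ oneMinusQ e        ≈⟨ ∙-congʳ (oneMinusQ e) (ih (suc B) D 1+B+D≡A) ⟩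
  qPoch k A ∙ oneMinusQ e                              ∎
  where
  open ≗-Reasoning
  G = gauss k A (suc B)
  e = k * suc D
  1+B+D≡A : suc B + D ≡ A
  1+B+D≡A = ℕₚ.suc-injective (trans (sym (ℕₚ.+-suc (suc B) D)) eq)

-- Multiplied out, the q-Pascal recurrence defining gauss is the telescoping
-- (1 - q^{k(B+1)}) + q^{k(B+1)} (1 - q^{kD}) = 1 - q^{k(A+1)}.
gaussPoch-suc : ∀ k {A} → GaussPoch k A → GaussPoch k (suc A)
gaussPoch-suc k {A} ih zero    D eq = gaussPoch-zero k (suc A) D (sym eq)
gaussPoch-suc k {A} ih (suc B) D eq = begin
  (gauss k A B ⊕ shift e G) ∙ qPoch k (suc B) ∙ qPoch k D
    ≈⟨ ∙-congʳ (qPoch k D) (∙-distribʳ-⊕ _ _ _) ⟩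
  (gauss k A B ∙ qPoch k (suc B) ⊕ shift e G ∙ qPoch k (suc B)) ∙ qPoch k D
    ≈⟨ ∙-distribʳ-⊕ _ _ _ ⟩
  gauss k A B ∙ qPoch k (suc B) ∙ qPoch k D ⊕ shift e G ∙ qPoch k (suc B) ∙ qPoch k D
    ≈⟨ ⊕-cong (gaussPoch-low k ih B D (ℕₚ.suc-injective eq)) shifted ⟩
  qPoch k A ∙ oneMinusQ e ⊕ shift e (qPoch k A ∙ oneMinusQ (k * D))
    ≈⟨ ⊕-cong {qPoch k A ∙ oneMinusQ e} (λ _ → refl) (∙-shift e (qPoch k A) _) ⟨
  qPoch k A ∙ oneMinusQ e ⊕ qPoch k A ∙ shift e (oneMinusQ (k * D))
    ≈⟨ ∙-distribˡ-⊕ (qPoch k A) _ _ ⟨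
  qPoch k A ∙ (oneMinusQ e ⊕ shift e (oneMinusQ (k * D)))
    ≈⟨ ∙-congˡ (qPoch k A) (oneMinusQ-+ e (k * D)) ⟩
  qPoch k A ∙ oneMinusQ (e + k * D)
    ≡⟨ cong (λ d → qPoch k A ∙ oneMinusQ d) (trans (sym (ℕₚ.*-distribˡ-+ k (suc B) D)) (cong (_*_ k) eq)) ⟩
  qPoch k A ∙ oneMinusQ (k * suc A)
    ≈⟨ qPoch-suc k A ⟨
  qPoch k (suc A) ∎
  where
  open ≗-Reasoning
  e = k * suc B
  G = gauss k A (suc B)
  shifted : shift e G ∙ qPoch k (suc B) ∙ qPoch k D ≗ shift e (qPoch k A ∙ oneMinusQ (k * D))
  shifted = begin
    shift e G ∙ qPoch k (suc B) ∙ qPoch k D    ≈⟨ ∙-congʳ (qPoch k D) (shift-∙ e G _) ⟩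
    shift e (G ∙ qPoch k (suc B)) ∙ qPoch k D  ≈⟨ shift-∙ e _ _ ⟩
    shift e (G ∙ qPoch k (suc B) ∙ qPoch k D)  ≈⟨ shift-cong e (gaussPoch-high k ih B D eq) ⟩
    shift e (qPoch k A ∙ oneMinusQ (k * D))    ∎

gaussPoch : ∀ k A → GaussPoch k A
gaussPoch k zero    zero    D eq = gaussPoch-zero k 0 D (sym eq)
gaussPoch k (suc A)         = gaussPoch-suc k (gaussPoch k A)

qBinom≗gauss : ∀ k A B → qBinom (suc k) A B ≗ gauss (suc k) A B
qBinom≗gauss k A B with ℕₚ.≤-<-connex B A
... | inj₂ A<B = λ n →
  trans (cong-app (if-¬T (ℕₚ.<⇒≱ A<B ∘ ℕₚ.≤ᵇ⇒≤ B A)) n) (sym (gauss-vanishes (suc k) A<B n))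
... | inj₁ B≤A = begin
  qBinom (suc k) A B                               ≡⟨ if-T (ℕₚ.≤⇒≤ᵇ B≤A) ⟩
  P A ⊛ I B ⊛ I D                                  ≈⟨ ⊛≗∙ _ _ ⟩
  (P A ⊛ I B) ∙ I D                                ≈⟨ ∙-congʳ (I D) (⊛≗∙ _ _) ⟩
  P A ∙ I B ∙ I D                                  ≈⟨ ∙-congʳ (I D) (∙-congʳ (I B) (gaussPoch (suc k) A B D B+D≡A)) ⟨
  G ∙ P B ∙ P D ∙ I B ∙ I D                        ≈⟨ ∙-assoc _ _ _ ⟩
  G ∙ P B ∙ P D ∙ (I B ∙ I D)                      ≈⟨ interchange _ _ _ _ ⟩
  G ∙ P B ∙ I B ∙ (P D ∙ I D)                      ≈⟨ ∙-cong (∙-assoc G (P B) (I B)) (qPoch∙qPochInv k D) ⟩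
  G ∙ (P B ∙ I B) ∙ onePS                          ≈⟨ ∙-identityʳ _ ⟩
  G ∙ (P B ∙ I B)                                  ≈⟨ ∙-congˡ G (qPoch∙qPochInv k B) ⟩
  G ∙ onePS                                        ≈⟨ ∙-identityʳ G ⟩
  G                                                ∎
  where
  open ≗-Reasoning
  P = qPoch (suc k)
  I = qPochInv (suc k)
  D = A ∸ B
  G = gauss (suc k) A B
  B+D≡A : B + D ≡ A
  B+D≡A = ℕₚ.m+[n∸m]≡n B≤A

-- Markings and the Rothe-type identity

-- Positions are numbered 0, 1, …, L - 1 from the top; a marked position i
-- contributes q^{t+i}, and the position i may only be marked if k ∣ L - i.
flagGF : ℕ → ℕ → ℕ → ℕ → PS
flagGF k t zero    zero    = onePS
flagGF k t zero    (suc a) = zeroPS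
flagGF k t (suc L) zero    = flagGF k (suc t) L zero
flagGF k t (suc L) (suc a) =
  flagGF k (suc t) L (suc a) ⊕ (if ⌊ k ∣? suc L ⌋ then shift t (flagGF k (suc t) L a) else zeroPS)

flagGF-≡ : ∀ k {t t′ L L′} a → t ≡ t′ → L ≡ L′ → flagGF k t L a ≗ flagGF k t′ L′ a
flagGF-≡ k a refl refl n = refl

flagGF-unmarked : ∀ k t L → flagGF k t L 0 ≗ onePS
flagGF-unmarked k t zero    = λ _ → refl
flagGF-unmarked k t (suc L) = flagGF-unmarked k (suc t) L

flagGF-skip : ∀ k t L a → ¬ k ∣ suc L → flagGF k t (suc L) a ≗ flagGF k (suc t) L a
flagGF-skip k t L zero    _   = λ _ → refl
flagGF-skip k t L (suc a) k∤ n =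
  trans (cong (ℤ._+_ (flagGF k (suc t) L (suc a) n))
              (cong-app (if-¬T {b = ⌊ k ∣? suc L ⌋} (k∤ ∘ toWitness {a? = k ∣? suc L})) n))
        (⊕-identityʳ (flagGF k (suc t) L (suc a)) n)

flagGF-mark : ∀ k t L a → k ∣ suc L →
  flagGF k t (suc L) (suc a) ≗ flagGF k (suc t) L (suc a) ⊕ shift t (flagGF k (suc t) L a)
flagGF-mark k t L a k∣ n =
  cong (ℤ._+_ (flagGF k (suc t) L (suc a) n))
       (cong-app (if-T {b = ⌊ k ∣? suc L ⌋} (fromWitness {a? = k ∣? suc L} k∣)) n)

flagGF-skips : ∀ k t L a r → (∀ {i} → i < r → ¬ k ∣ suc (i + L)) →
  flagGF k t (r + L) a ≗ flagGF k (t + r) L a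
flagGF-skips k t L a zero    _  = flagGF-≡ k {L = L} a (sym (ℕₚ.+-identityʳ t)) refl
flagGF-skips k t L a (suc r) k∤ = begin
  flagGF k t (suc (r + L)) a  ≈⟨ flagGF-skip k t (r + L) a (k∤ ℕₚ.≤-refl) ⟩
  flagGF k (suc t) (r + L) a  ≈⟨ flagGF-skips k (suc t) L a r (k∤ ∘ ℕₚ.m<n⇒m<1+n) ⟩
  flagGF k (suc t + r) L a    ≈⟨ flagGF-≡ k {L = L} a (sym (ℕₚ.+-suc t r)) refl ⟩
  flagGF k (t + suc r) L a    ∎
  where open ≗-Reasoning

∤suc+* : ∀ k M i → suc i < k → ¬ k ∣ suc (i + k * M)
∤suc+* k M i 1+i<k k∣ =
  ℕₚ.<⇒≱ 1+i<k (∣⇒≤ (∣m+n∣m⇒∣n (subst (k ∣_) (ℕₚ.+-comm (suc i) (k * M)) k∣) (m∣m*n M)))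

flagGF-skips-block : ∀ k M r t a → r < suc k →
  flagGF (suc k) t (r + suc k * M) a ≗ flagGF (suc k) (t + r) (suc k * M) a
flagGF-skips-block k M r t a r<k =
  flagGF-skips (suc k) t (suc k * M) a r (λ i<r → ∤suc+* (suc k) M _ (ℕₚ.<-≤-trans (s<s i<r) r<k))

sucC2 : ∀ a → suc a C 2 ≡ a + a C 2
sucC2 a = trans (sym (nCk+nC[k+1]≡[n+1]C[k+1] a 1)) (cong (_+ a C 2) (nC1≡n a))

flagGF-block : ∀ k M t a →
  flagGF (suc k) t (suc k * M) a ≗ shift (t * a + suc k * (a C 2)) (gauss (suc k) M a)
flagGF-block k M t zero = begin
  flagGF (suc k) t (suc k * M) 0  ≈⟨ flagGF-unmarked (suc k) t (suc k * M) ⟩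
  onePS                           ≈⟨ shift-≡ onePS exponent ⟨
  shift (t * 0 + suc k * 0) onePS ∎
  where
  open ≗-Reasoning
  exponent : t * 0 + suc k * 0 ≡ 0
  exponent = cong₂ _+_ (ℕₚ.*-zeroʳ t) (ℕₚ.*-zeroʳ (suc k))
flagGF-block k zero t (suc a) = begin
  flagGF (suc k) t (suc k * 0) (suc a)  ≈⟨ flagGF-≡ (suc k) (suc a) refl (ℕₚ.*-zeroʳ (suc k)) ⟩
  zeroPS                                ≈⟨ shift-zeroPS E ⟨
  shift E zeroPS                        ∎
  where
  open ≗-Reasoning
  E = t * suc a + suc k * (suc a C 2)
flagGF-block k (suc M) t (suc a) = begin
  flagGF K t (K * suc M) (suc a)
    ≈⟨ flagGF-≡ K (suc a) refl (ℕₚ.*-suc K M) ⟩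
  flagGF K t (suc (k + K * M)) (suc a)
    ≈⟨ flagGF-mark K t (k + K * M) a (subst (K ∣_) (ℕₚ.*-suc K M) (m∣m*n (suc M))) ⟩
  flagGF K (suc t) (k + K * M) (suc a) ⊕ shift t (flagGF K (suc t) (k + K * M) a)
    ≈⟨ ⊕-cong (skips (suc a)) (shift-cong t (skips a)) ⟩
  flagGF K (t + K) (K * M) (suc a) ⊕ shift t (flagGF K (t + K) (K * M) a)
    ≈⟨ ⊕-cong (flagGF-block k M (t + K) (suc a)) (shift-cong t (flagGF-block k M (t + K) a)) ⟩
  shift E₁ (gauss K M (suc a)) ⊕ shift t (shift E₂ (gauss K M a))
    ≈⟨ ⊕-cong (shift-≡ _ e₁) (λ n → trans (shift-+ t E₂ _ n) (shift-≡ _ e₂ n)) ⟩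
  shift (K * suc a + E) (gauss K M (suc a)) ⊕ shift E (gauss K M a)
    ≈⟨ shift-gauss-pascal K M a E ⟩
  shift E (gauss K (suc M) (suc a)) ∎
  where
  open ≗-Reasoning
  K  = suc k
  E  = t * suc a + K * (suc a C 2)
  E₁ = (t + K) * suc a + K * (suc a C 2)
  E₂ = (t + K) * a + K * (a C 2)
  skips : ∀ b → flagGF K (suc t) (k + K * M) b ≗ flagGF K (t + K) (K * M) b
  skips b n = trans (flagGF-skips-block k M k (suc t) b ℕₚ.≤-refl n)
                    (flagGF-≡ K {L = K * M} b (sym (ℕₚ.+-suc t k)) refl n)
  e₁ : E₁ ≡ K * suc a + E
  e₁ = lemma t K a (suc a C 2)
    where
    lemma : ∀ t K a c → (t + K) * suc a + K * c ≡ K * suc a + (t * suc a + K * c)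
    lemma = ℕ-Solver.solve-∀
  e₂ : t + E₂ ≡ E
  e₂ = trans (lemma t K a (a C 2)) (cong (λ c → t * suc a + K * c) (sym (sucC2 a)))
    where
    lemma : ∀ t K a c → t + ((t + K) * a + K * c) ≡ t * suc a + K * (a + c)
    lemma = ℕ-Solver.solve-∀

flagGF-gauss : ∀ k M r t a → r < suc k →
  flagGF (suc k) t (r + suc k * M) a ≗ shift ((t + r) * a + suc k * (a C 2)) (gauss (suc k) M a)
flagGF-gauss k M r t a r<k n =
  trans (flagGF-skips-block k M r t a r<k n) (flagGF-block k M (t + r) a n)

-- Regrouping the right-hand side by the number of parts

overPoch : ℕ → PS → PS
overPoch L X = shift L (qPochInv 1 L ∙ X)

overPoch-≡ : ∀ {L L′} X → L ≡ L′ → overPoch L X ≗ overPoch L′ X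
overPoch-≡ X refl n = refl

overPoch-cong : ∀ L {X Y} → X ≗ Y → overPoch L X ≗ overPoch L Y
overPoch-cong L X≗Y = shift-cong L (∙-congˡ (qPochInv 1 L) X≗Y)

overPoch-⊕ : ∀ L X Y → overPoch L (X ⊕ Y) ≗ overPoch L X ⊕ overPoch L Y
overPoch-⊕ L X Y n = trans (shift-cong L (∙-distribˡ-⊕ (qPochInv 1 L) X Y) n) (shift-⊕ L _ _ n)

overPoch-zeroPS : ∀ L → overPoch L zeroPS ≗ zeroPS
overPoch-zeroPS L n = trans (shift-cong L (∙-zeroʳ (qPochInv 1 L)) n) (shift-zeroPS L n)

layer : ℕ → ℕ → ℕ → PS
layer k a L = overPoch L (flagGF k 0 L a)

layer-zero : ∀ k a → layer k a 0 ≗ one2 a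
layer-zero k zero    n = ∙-identityˡ onePS n
layer-zero k (suc a) n = ∙-identityˡ zeroPS n

shiftPS-qBinom : ∀ k {E} L e M a → E ≡ L + e →
  shiftPS E (qPochInv 1 L ⊛ qBinom (suc k) M a) ≗ overPoch L (shift e (gauss (suc k) M a))
shiftPS-qBinom k L e M a refl = begin
  shiftPS (L + e) (qPochInv 1 L ⊛ qBinom (suc k) M a)  ≈⟨ shiftPS≗shift (L + e) _ ⟩
  shift (L + e) (qPochInv 1 L ⊛ qBinom (suc k) M a)    ≈⟨ shift-cong (L + e) (⊛≗∙ _ _) ⟩
  shift (L + e) (qPochInv 1 L ∙ qBinom (suc k) M a)    ≈⟨ shift-cong (L + e) (∙-congˡ _ (qBinom≗gauss k M a)) ⟩
  shift (L + e) (qPochInv 1 L ∙ gauss (suc k) M a)     ≈⟨ shift-+ L e _ ⟨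
  shift L (shift e (qPochInv 1 L ∙ gauss (suc k) M a)) ≈⟨ shift-cong L (∙-shift e _ _) ⟨
  overPoch L (shift e (gauss (suc k) M a))             ∎
  where open ≗-Reasoning

overPoch-gauss-vanishes : ∀ k L e {A B} → A < B → overPoch L (shift e (gauss k A B)) ≗ zeroPS
overPoch-gauss-vanishes k L e {A} {B} A<B n = begin
  overPoch L (shift e (gauss k A B)) n
    ≡⟨ overPoch-cong L (λ n → trans (shift-cong e (gauss-vanishes k A<B) n) (shift-zeroPS e n)) n ⟩
  overPoch L zeroPS n                   ≡⟨ overPoch-zeroPS L n ⟩
  + 0                                   ∎
  where open ≡-Reasoning

term1-row : ∀ k s m a n →
  σ (suc m) (λ i → term1 (suc k) s (suc m) (suc i) a n)
    ≡ overPoch (s + suc k * m) (shift (s * a + suc k * (a C 2)) (gauss (suc k) m a)) n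
term1-row k s m a n = [ absent , present ]′ (ℕₚ.<-≤-connex m a)
  where
  open ≡-Reasoning
  K = suc k
  e = s * a + K * (a C 2)
  entry : ℕ → ℤ
  entry i = shiftPS (K * (suc i C 2) + s * suc i + K * (m ∸ i)) (qPochInv 1 (K * m + s) ⊛ qBinom K m i) n
  absent : m < a → σ (suc m) (λ i → term1 K s (suc m) (suc i) a n) ≡ overPoch (s + K * m) (shift e (gauss K m a)) n
  absent m<a = trans (σ-select-none (suc m) entry m<a) (sym (overPoch-gauss-vanishes K (s + K * m) e m<a n))
  present : a ≤ m → σ (suc m) (λ i → term1 K s (suc m) (suc i) a n) ≡ overPoch (s + K * m) (shift e (gauss K m a)) n
  present a≤m = begin
    σ (suc m) (λ i → term1 K s (suc m) (suc i) a n)  ≡⟨ σ-select (suc m) entry (s≤s a≤m) ⟩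
    entry a                                          ≡⟨ shiftPS-qBinom k (K * m + s) e m a exponent n ⟩
    overPoch (K * m + s) (shift e (gauss K m a)) n   ≡⟨ overPoch-≡ _ (ℕₚ.+-comm (K * m) s) n ⟩
    overPoch (s + K * m) (shift e (gauss K m a)) n   ∎
    where
    lemma : ∀ K s a c d → K * (a + c) + s * suc a + K * d ≡ K * (a + d) + s + (s * a + K * c)
    lemma = ℕ-Solver.solve-∀
    exponent : K * (suc a C 2) + s * suc a + K * (m ∸ a) ≡ K * m + s + e
    exponent = begin
      K * (suc a C 2) + s * suc a + K * (m ∸ a)  ≡⟨ cong (λ c → K * c + s * suc a + K * (m ∸ a)) (sucC2 a) ⟩
      K * (a + a C 2) + s * suc a + K * (m ∸ a)  ≡⟨ lemma K s a (a C 2) (m ∸ a) ⟩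
      K * (a + (m ∸ a)) + s + e                  ≡⟨ cong (λ m → K * m + s + e) (ℕₚ.m+[n∸m]≡n a≤m) ⟩
      K * m + s + e                              ∎

term2-row-unmarked : ∀ k m n → σ (suc m) (λ i → term2 k (suc m) (suc i) 0 n) ≡ + 0
term2-row-unmarked k m n = σ-zero (suc m) (λ _ → refl)

term2-row : ∀ k m b n →
  σ (suc m) (λ i → term2 (suc k) (suc m) (suc i) (suc b) n)
    ≡ overPoch (suc k * suc m) (shift (suc k * (suc b C 2)) (gauss (suc k) m b)) n
term2-row k m b n = [ absent , present ]′ (ℕₚ.<-≤-connex m b)
  where
  K = suc k
  e = K * (suc b C 2)
  entry : ℕ → ℤ
  entry i = shiftPS (K * (suc i C 2) + K * suc m) (qPochInv 1 (K * suc m) ⊛ qBinom K m i) n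
  absent : m < b → σ (suc m) (λ i → term2 K (suc m) (suc i) (suc b) n) ≡ overPoch (K * suc m) (shift e (gauss K m b)) n
  absent m<b = trans (σ-select-none (suc m) entry m<b) (sym (overPoch-gauss-vanishes K (K * suc m) e m<b n))
  present : b ≤ m → σ (suc m) (λ i → term2 K (suc m) (suc i) (suc b) n) ≡ overPoch (K * suc m) (shift e (gauss K m b)) n
  present b≤m =
    trans (σ-select (suc m) entry (s≤s b≤m)) (shiftPS-qBinom k (K * suc m) e m b (ℕₚ.+-comm e (K * suc m)) n)

term1-row-layer : ∀ k m s a n → s < k →
  σ (suc m) (λ i → term1 (suc k) (suc s) (suc m) (suc i) a n) ≡ layer (suc k) a (suc s + suc k * m) n
term1-row-layer k m s a n s<k = trans (term1-row k (suc s) m a n)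
  (sym (overPoch-cong (suc s + suc k * m) (flagGF-gauss k m (suc s) 0 a (s<s s<k)) n))

layer-block : ∀ k m a →
  layer (suc k) a (suc k + suc k * m) ≗ overPoch (suc k + suc k * m) (shift (suc k * (a C 2)) (gauss (suc k) (suc m) a))
layer-block k m a = overPoch-cong (suc k + suc k * m) λ n →
  trans (flagGF-≡ (suc k) a refl (sym (ℕₚ.*-suc (suc k) m)) n) (flagGF-block k (suc m) 0 a n)

term1-term2-row-layer : ∀ k m a n →
  σ (suc m) (λ i → term1 (suc k) (suc k) (suc m) (suc i) a n) ℤ.+ σ (suc m) (λ i → term2 (suc k) (suc m) (suc i) a n)
    ≡ layer (suc k) a (suc k + suc k * m) n
term1-term2-row-layer k m zero n = begin
  σ (suc m) (λ i → term1 K K (suc m) (suc i) 0 n) ℤ.+ σ (suc m) (λ i → term2 K (suc m) (suc i) 0 n)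
    ≡⟨ cong₂ ℤ._+_ (term1-row k K m 0 n) (term2-row-unmarked K m n) ⟩
  overPoch ℓ (shift (K * 0 + K * 0) onePS) n ℤ.+ + 0
    ≡⟨ ℤₚ.+-identityʳ _ ⟩
  overPoch ℓ (shift (K * 0 + K * 0) onePS) n
    ≡⟨ overPoch-cong ℓ (shift-≡ onePS (cong (_+ K * 0) (ℕₚ.*-zeroʳ K))) n ⟩
  overPoch ℓ (shift (K * 0) onePS) n
    ≡⟨ layer-block k m 0 n ⟨
  layer K 0 ℓ n ∎
  where
  open ≡-Reasoning
  K = suc k
  ℓ = K + K * m
term1-term2-row-layer k m (suc b) n = begin
  σ (suc m) (λ i → term1 K K (suc m) (suc i) (suc b) n) ℤ.+ σ (suc m) (λ i → term2 K (suc m) (suc i) (suc b) n)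
    ≡⟨ cong₂ ℤ._+_ (term1-row k K m (suc b) n) (trans (term2-row k m b n) (overPoch-≡ _ (ℕₚ.*-suc K m) n)) ⟩
  overPoch ℓ (shift (K * suc b + c) (gauss K m (suc b))) n ℤ.+ overPoch ℓ (shift c (gauss K m b)) n
    ≡⟨ overPoch-⊕ ℓ _ _ n ⟨
  overPoch ℓ (shift (K * suc b + c) (gauss K m (suc b)) ⊕ shift c (gauss K m b)) n
    ≡⟨ overPoch-cong ℓ (shift-gauss-pascal K m b c) n ⟩
  overPoch ℓ (shift c (gauss K (suc m) (suc b))) n
    ≡⟨ layer-block k m (suc b) n ⟨
  layer K (suc b) ℓ n ∎
  where
  open ≡-Reasoning
  K = suc k
  ℓ = K + K * m
  c = K * (suc b C 2)

rhs-column : ∀ k m a n →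
  σ (suc k) (λ s → σ (suc m) (λ i → term1 (suc k) (suc s) (suc m) (suc i) a n))
    ℤ.+ σ (suc m) (λ i → term2 (suc k) (suc m) (suc i) a n)
    ≡ σ (suc k) (λ s → layer (suc k) a (suc s + suc k * m) n)
rhs-column k m a n = begin
  σ (suc k) row ℤ.+ B                  ≡⟨ cong (ℤ._+ B) (σ-last k row) ⟩
  σ k row ℤ.+ row k ℤ.+ B              ≡⟨ ℤₚ.+-assoc (σ k row) (row k) B ⟩
  σ k row ℤ.+ (row k ℤ.+ B)
    ≡⟨ cong₂ ℤ._+_ (σ-cong k (term1-row-layer k m _ a n)) (term1-term2-row-layer k m a n) ⟩
  σ k layerAt ℤ.+ layerAt k            ≡⟨ σ-last k layerAt ⟨
  σ (suc k) layerAt                    ∎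
  where
  open ≡-Reasoning
  row : ℕ → ℤ
  row s = σ (suc m) (λ i → term1 (suc k) (suc s) (suc m) (suc i) a n)
  B = σ (suc m) (λ i → term2 (suc k) (suc m) (suc i) a n)
  layerAt : ℕ → ℤ
  layerAt s = layer (suc k) a (suc s + suc k * m) n

rhsPartial≡σ-layer : ∀ k M a n → rhsPartial (suc k) M a n ≡ σ (suc (suc k * M)) (λ L → layer (suc k) a L n)
rhsPartial≡σ-layer k M a n = begin
  one2 a n ℤ.+ S₁ ℤ.+ S₂
    ≡⟨ ℤₚ.+-assoc (one2 a n) S₁ S₂ ⟩
  one2 a n ℤ.+ (S₁ ℤ.+ S₂)
    ≡⟨ cong₂ ℤ._+_ (sym (layer-zero K a n)) (cong₂ ℤ._+_ (trans S₁≡ (σ-comm K M A)) S₂≡) ⟩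
  layer K a 0 n ℤ.+ (σ M (λ m → σ K (λ s → A s m)) ℤ.+ σ M B)
    ≡⟨ cong (ℤ._+_ (layer K a 0 n)) (σ-distrib-+ M (λ m → σ K (λ s → A s m)) B) ⟨
  layer K a 0 n ℤ.+ σ M (λ m → σ K (λ s → A s m) ℤ.+ B m)
    ≡⟨ cong (ℤ._+_ (layer K a 0 n)) (σ-cong-≗ M (λ m → rhs-column k m a n)) ⟩
  layer K a 0 n ℤ.+ σ M (λ m → σ K (λ s → layer K a (suc s + K * m) n))
    ≡⟨ cong (ℤ._+_ (layer K a 0 n)) (σ-* K M (λ L → layer K a (suc L) n)) ⟨
  layer K a 0 n ℤ.+ σ (K * M) (λ L → layer K a (suc L) n) ∎
  where
  open ≡-Reasoning
  K = suc k
  S₁ = ΣℤRange 1 K (λ s → ΣℤRange 1 M (λ m → ΣℤRange 1 m (λ j → term1 K s m j a n)))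
  S₂ = ΣℤRange 1 M (λ m → ΣℤRange 1 m (λ j → term2 K m j a n))
  A : ℕ → ℕ → ℤ
  A s m = σ (suc m) (λ i → term1 K (suc s) (suc m) (suc i) a n)
  B : ℕ → ℤ
  B m = σ (suc m) (λ i → term2 K (suc m) (suc i) a n)
  S₁≡ : S₁ ≡ σ K (λ s → σ M (A s))
  S₁≡ = trans (ΣℤRange≡σ 1 K (λ s → ΣℤRange 1 M (λ m → ΣℤRange 1 m (λ j → term1 K s m j a n))))
          (σ-cong-≗ K (λ s → trans (ΣℤRange≡σ 1 M (λ m → ΣℤRange 1 m (λ j → term1 K (suc s) m j a n)))
            (σ-cong-≗ M (λ m → ΣℤRange≡σ 1 (suc m) (λ j → term1 K (suc s) (suc m) j a n)))))
  S₂≡ : S₂ ≡ σ M B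
  S₂≡ = trans (ΣℤRange≡σ 1 M (λ m → ΣℤRange 1 m (λ j → term2 K m j a n)))
          (σ-cong-≗ M (λ m → ΣℤRange≡σ 1 (suc m) (λ j → term2 K (suc m) j a n)))

Card : ℤ → Set → Set
Card z X = Σ ℕ λ c → z ≡ + c × (Fin c ↔ X)

Card-↔ : ∀ {z X Y} → Card z X → X ↔ Y → Card z Y
Card-↔ (c , z≡c , Fin↔X) X↔Y = c , z≡c , ↔-trans Fin↔X X↔Y

Card-≡ : ∀ {z w X} → z ≡ w → Card z X → Card w X
Card-≡ refl card = card

Card-unique : ∀ {z w X} → Card z X → Card w X → z ≡ w
Card-unique (c , refl , Fin↔X) (d , refl , Fin↔X′) = cong +_ (↔⇒≡ (↔-trans Fin↔X (↔-sym Fin↔X′)))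

Card-⊥ : Card (+ 0) ⊥
Card-⊥ = 0 , refl , 0↔⊥

Card-⊤ : Card (+ 1) ⊤
Card-⊤ = 1 , refl , 1↔⊤

Card-empty : ∀ {X} → ¬ X → Card (+ 0) X
Card-empty ¬x = Card-↔ Card-⊥ (mk↔ₛ′ (λ ()) ¬x (λ x → contradiction x ¬x) (λ ()))

Card-⊎ : ∀ {z w X Y} → Card z X → Card w Y → Card (z ℤ.+ w) (X ⊎ Y)
Card-⊎ (c , refl , Fin↔X) (d , refl , Fin↔Y) = c + d , refl , ↔-trans +↔⊎ (Fin↔X ⊎-↔ Fin↔Y)

Card-× : ∀ {z w X Y} → Card z X → Card w Y → Card (z ℤ.* w) (X × Y)
Card-× (c , refl , Fin↔X) (d , refl , Fin↔Y) = c * d , sym (ℤₚ.pos-* c d) , ↔-trans *↔× (Fin↔X ×-↔ Fin↔Y)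

Card-σ : ∀ N {f : ℕ → ℤ} {X : ℕ → Set} → (∀ i → Card (f i) (X i)) →
  Card (σ N f) (Σ ℕ λ i → i < N × X i)
Card-σ zero    card = Card-empty λ ()
Card-σ (suc N) {X = X} card =
  Card-↔ (Card-⊎ (card 0) (Card-σ N (card ∘ suc))) (mk↔ₛ′ to from to∘from from∘to)
  where
  to : X 0 ⊎ (Σ ℕ λ i → i < N × X (suc i)) → Σ ℕ λ i → i < suc N × X i
  to (inj₁ x)             = 0 , z<s , x
  to (inj₂ (i , i<N , x)) = suc i , s<s i<N , x
  from : (Σ ℕ λ i → i < suc N × X i) → X 0 ⊎ (Σ ℕ λ i → i < N × X (suc i))
  from (zero  , _         , x) = inj₁ x
  from (suc i , s<s i<N , x) = inj₂ (i , i<N , x)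
  to∘from : ∀ y → to (from y) ≡ y
  to∘from (zero  , z<s     , x) = refl
  to∘from (suc i , s<s _ , x) = refl
  from∘to : ∀ x → from (to x) ≡ x
  from∘to (inj₁ x) = refl
  from∘to (inj₂ x) = refl

Σ-≡-irrelevant : ∀ {X : Set} {P : X → Set} → (∀ x → Irrelevant (P x)) →
  ∀ {x y} {p : P x} {q : P y} → x ≡ y → (x , p) ≡ (y , q)
Σ-≡-irrelevant P-irr {x} refl = cong (x ,_) (P-irr x _ _)

Fiber : {X : Set} → (X → ℕ) → ℕ → Set
Fiber {X} w n = Σ X λ x → w x ≡ n

IsGF : PS → {X : Set} → (X → ℕ) → Set
IsGF f w = ∀ n → Card (f n) (Fiber w n)

IsGF-≗ : ∀ {f g X} {w : X → ℕ} → f ≗ g → IsGF f w → IsGF g w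
IsGF-≗ f≗g gf n = Card-≡ (f≗g n) (gf n)

IsGF-↔ : ∀ {f X Y} {w : X → ℕ} {v : Y → ℕ} (X↔Y : X ↔ Y) →
  (∀ x → v (Inverse.to X↔Y x) ≡ w x) → IsGF f w → IsGF f v
IsGF-↔ {w = w} {v} X↔Y v∘to≡w gf n = Card-↔ (gf n) (mk↔ₛ′ to′ from′ to∘from from∘to)
  where
  open Inverse X↔Y
  to′ : Fiber w n → Fiber v n
  to′ (x , wx≡n) = to x , trans (v∘to≡w x) wx≡n
  from′ : Fiber v n → Fiber w n
  from′ (y , vy≡n) = from y , trans (sym (v∘to≡w (from y))) (trans (cong v (strictlyInverseˡ y)) vy≡n)
  to∘from : ∀ y → to′ (from′ y) ≡ y
  to∘from (y , _) = Σ-≡-irrelevant (λ _ → ℕₚ.≡-irrelevant) (strictlyInverseˡ y)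
  from∘to : ∀ x → from′ (to′ x) ≡ x
  from∘to (x , _) = Σ-≡-irrelevant (λ _ → ℕₚ.≡-irrelevant) (strictlyInverseʳ x)

IsGF-onePS : IsGF onePS (λ (_ : ⊤) → 0)
IsGF-onePS zero    = Card-↔ Card-⊤ (mk↔ₛ′ (λ _ → tt , refl) (λ _ → tt)
                       (λ { (tt , p) → cong (tt ,_) (ℕₚ.≡-irrelevant refl p) }) (λ _ → refl))
IsGF-onePS (suc n) = Card-empty λ ()

IsGF-empty : ∀ {X} {w : X → ℕ} → ¬ X → IsGF zeroPS w
IsGF-empty ¬x n = Card-empty (¬x ∘ proj₁)

IsGF-⊕ : ∀ {f g X Y} {w : X → ℕ} {v : Y → ℕ} → IsGF f w → IsGF g v → IsGF (f ⊕ g) [ w , v ]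
IsGF-⊕ {w = w} {v} gf gg n = Card-↔ (Card-⊎ (gf n) (gg n)) (mk↔ₛ′ to from to∘from from∘to)
  where
  to : Fiber w n ⊎ Fiber v n → Fiber [ w , v ] n
  to (inj₁ (x , p)) = inj₁ x , p
  to (inj₂ (y , p)) = inj₂ y , p
  from : Fiber [ w , v ] n → Fiber w n ⊎ Fiber v n
  from (inj₁ x , p) = inj₁ (x , p)
  from (inj₂ y , p) = inj₂ (y , p)
  to∘from : ∀ z → to (from z) ≡ z
  to∘from (inj₁ x , p) = refl
  to∘from (inj₂ y , p) = refl
  from∘to : ∀ z → from (to z) ≡ z
  from∘to (inj₁ _) = refl
  from∘to (inj₂ _) = refl

IsGF-∙ : ∀ {f g X Y} {w : X → ℕ} {v : Y → ℕ} → IsGF f w → IsGF g v → IsGF (f ∙ g) (λ (x , y) → w x + v y)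
IsGF-∙ {f} {g} {X} {Y} {w} {v} gf gg n =
  Card-≡ (sym (∙-σ f g n))
    (Card-↔ (Card-σ (suc n) (λ i → Card-× (gf i) (gg (n ∸ i)))) (mk↔ₛ′ to from to∘from from∘to))
  where
  Split = Σ ℕ λ i → i < suc n × (Fiber w i × Fiber v (n ∸ i))
  to : Split → Fiber (λ (x , y) → w x + v y) n
  to (i , i<1+n , (x , refl) , (y , vy≡n∸i)) =
    (x , y) , trans (cong (_+_ (w x)) vy≡n∸i) (ℕₚ.m+[n∸m]≡n (ℕₚ.≤-pred i<1+n))
  from : Fiber (λ (x , y) → w x + v y) n → Split
  from ((x , y) , w+v≡n) = w x , s≤s (subst (w x ≤_) w+v≡n (ℕₚ.m≤m+n (w x) (v y))) , (x , refl) ,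
                           (y , trans (sym (ℕₚ.m+n∸m≡n (w x) (v y))) (cong (_∸ w x) w+v≡n))
  to∘from : ∀ z → to (from z) ≡ z
  to∘from (xy , _) = cong (xy ,_) (ℕₚ.≡-irrelevant _ _)
  from∘to : ∀ z → from (to z) ≡ z
  from∘to (i , _ , (x , refl) , (y , _)) =
    cong₂ (λ i<1+n q → w x , i<1+n , (x , refl) , (y , q)) (ℕₚ.<-irrelevant _ _) (ℕₚ.≡-irrelevant _ _)

IsGF-shift : ∀ e {f X} {w : X → ℕ} → IsGF f w → IsGF (shift e f) (λ x → e + w x)
IsGF-shift zero    gf = gf
IsGF-shift (suc e) gf zero    = Card-empty λ ()
IsGF-shift (suc e) {w = w} gf (suc n) = Card-↔ (IsGF-shift e gf n) (mk↔ₛ′ to from to∘from from∘to)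
  where
  to : Fiber (λ x → e + w x) n → Fiber (λ x → suc e + w x) (suc n)
  to (x , p) = x , cong suc p
  from : Fiber (λ x → suc e + w x) (suc n) → Fiber (λ x → e + w x) n
  from (x , p) = x , ℕₚ.suc-injective p
  to∘from : ∀ z → to (from z) ≡ z
  to∘from (x , _) = cong (x ,_) (ℕₚ.≡-irrelevant _ _)
  from∘to : ∀ z → from (to z) ≡ z
  from∘to (x , _) = cong (x ,_) (ℕₚ.≡-irrelevant _ _)

IsGF-σ : ∀ N {F : ℕ → PS} {X : ℕ → Set} {w : ∀ i → X i → ℕ} → (∀ i → IsGF (F i) (w i)) →
  IsGF (λ n → σ N (λ i → F i n)) (λ ((i , _ , x) : Σ ℕ λ i → i < N × X i) → w i x)
IsGF-σ N {X = X} {w} gf n = Card-↔ (Card-σ N (λ i → gf i n)) (mk↔ₛ′ to from (λ _ → refl) (λ _ → refl))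
  where
  to : (Σ ℕ λ i → i < N × Fiber (w i) n) → Fiber (λ ((i , _ , x) : Σ ℕ λ i → i < N × X i) → w i x) n
  to (i , i<N , x , p) = (i , i<N , x) , p
  from : Fiber (λ ((i , _ , x) : Σ ℕ λ i → i < N × X i) → w i x) n → Σ ℕ λ i → i < N × Fiber (w i) n
  from ((i , i<N , x) , p) = i , i<N , x , p

IsGF-if : ∀ b {f X} {w : X → ℕ} → IsGF f w → IsGF (if b then f else zeroPS) (λ ((_ , x) : T b × X) → w x)
IsGF-if true  gf = IsGF-↔ (mk↔ₛ′ (tt ,_) proj₂ (λ _ → refl) (λ _ → refl)) (λ _ → refl) gf
IsGF-if false gf = IsGF-empty proj₁

IsGF-geomPS : ∀ e → IsGF (geomPS (suc e)) (λ t → suc e * t)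
IsGF-geomPS e n with suc e ∣? n
... | yes d∣n@(divides t n≡td) = Card-≡ (sym (geomPS-∣ e n d∣n))
  (Card-↔ Card-⊤ (mk↔ₛ′ (λ _ → t , dt≡n) (λ _ → tt) unique (λ _ → refl)))
  where
  dt≡n : suc e * t ≡ n
  dt≡n = trans (ℕₚ.*-comm (suc e) t) (sym n≡td)
  unique : ∀ y → (t , dt≡n) ≡ y
  unique (t′ , dt′≡n) =
    Σ-≡-irrelevant (λ _ → ℕₚ.≡-irrelevant) (ℕₚ.*-cancelˡ-≡ t t′ (suc e) (trans dt≡n (sym dt′≡n)))
... | no d∤n = Card-≡ (sym (geomPS-∤ e n d∤n))
  (Card-empty λ (t , dt≡n) → d∤n (divides t (trans (sym dt≡n) (ℕₚ.*-comm (suc e) t))))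

gapWeight : ∀ {L} → ℕ → Vec ℕ L → ℕ
gapWeight t []       = 0
gapWeight t (x ∷ xs) = suc t * x + gapWeight (suc t) xs

×↔Vec-suc : ∀ {A : Set} {L} → (A × Vec A L) ↔ Vec A (suc L)
×↔Vec-suc = mk↔ₛ′ (λ p → proj₁ p ∷ proj₂ p) (λ { (x ∷ xs) → x , xs })
                  (λ { (x ∷ xs) → refl }) (λ _ → refl)

IsGF-gaps : ∀ t L → IsGF (∏ L (λ i → geomPS (suc (i + t)))) (gapWeight {L} t)
IsGF-gaps t zero    =
  IsGF-↔ (mk↔ₛ′ (λ _ → []) (λ _ → tt) (λ { [] → refl }) (λ _ → refl)) (λ _ → refl) IsGF-onePS
IsGF-gaps t (suc L) = IsGF-↔ ×↔Vec-suc (λ _ → refl) (IsGF-∙ (IsGF-geomPS t) (IsGF-≗ reindex (IsGF-gaps (suc t) L)))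
  where
  reindex : ∏ L (λ i → geomPS (suc (i + suc t))) ≗ ∏ L (λ i → geomPS (suc (suc i + t)))
  reindex = ∏-cong L (λ i n → cong (λ d → geomPS (suc d) n) (ℕₚ.+-suc i t))

-- skip and mark add a new top position above the L existing ones.
data Marking (k : ℕ) : ℕ → ℕ → Set where
  []   : Marking k 0 0
  skip : ∀ {L a} → Marking k L a → Marking k (suc L) a
  mark : ∀ {L a} → T ⌊ k ∣? suc L ⌋ → Marking k L a → Marking k (suc L) (suc a)

markWeight : ∀ {k L a} → ℕ → Marking k L a → ℕ
markWeight t []         = 0
markWeight t (skip m)   = markWeight (suc t) m
markWeight t (mark _ m) = t + markWeight (suc t) m

IsGF-marking : ∀ k t L a → IsGF (flagGF k t L a) (markWeight {k} {L} {a} t)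
IsGF-marking k t zero    zero    =
  IsGF-↔ (mk↔ₛ′ (λ _ → []) (λ _ → tt) (λ { [] → refl }) (λ _ → refl)) (λ _ → refl) IsGF-onePS
IsGF-marking k t zero    (suc a) = IsGF-empty λ ()
IsGF-marking k t (suc L) zero    =
  IsGF-↔ (mk↔ₛ′ skip (λ { (skip m) → m }) (λ { (skip m) → refl }) (λ _ → refl)) (λ _ → refl)
    (IsGF-marking k (suc t) L zero)
IsGF-marking k t (suc L) (suc a) =
  IsGF-↔ (mk↔ₛ′ to from to∘from from∘to) (λ { (inj₁ _) → refl ; (inj₂ _) → refl })
    (IsGF-⊕ (IsGF-marking k (suc t) L (suc a)) (IsGF-if ⌊ k ∣? suc L ⌋ (IsGF-shift t (IsGF-marking k (suc t) L a))))
  where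
  to : Marking k L (suc a) ⊎ (T ⌊ k ∣? suc L ⌋ × Marking k L a) → Marking k (suc L) (suc a)
  to (inj₁ m)       = skip m
  to (inj₂ (k∣ , m)) = mark k∣ m
  from : Marking k (suc L) (suc a) → Marking k L (suc a) ⊎ (T ⌊ k ∣? suc L ⌋ × Marking k L a)
  from (skip m)    = inj₁ m
  from (mark k∣ m) = inj₂ (k∣ , m)
  to∘from : ∀ m → to (from m) ≡ m
  to∘from (skip m)   = refl
  to∘from (mark _ m) = refl
  from∘to : ∀ m → from (to m) ≡ m
  from∘to (inj₁ _) = refl
  from∘to (inj₂ _) = refl

Code : ℕ → ℕ → Set
Code k a = Σ ℕ λ L → Vec ℕ L × Marking k L a

codeWeight : ∀ {k a} → Code k a → ℕ
codeWeight (L , xs , m) = L + (gapWeight 0 xs + markWeight 0 m)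

IsGF-layer : ∀ k a L →
  IsGF (layer k a L) (λ ((xs , m) : Vec ℕ L × Marking k L a) → L + (gapWeight 0 xs + markWeight 0 m))
IsGF-layer k a L =
  IsGF-shift L (IsGF-∙ (IsGF-≗ (λ n → sym (qPochInv≗∏ 1 L n)) (IsGF-gaps 0 L)) (IsGF-marking k 0 L a))

BoundedCode : ℕ → ℕ → ℕ → Set
BoundedCode k a N = Σ ℕ λ L → L < N × (Vec ℕ L × Marking k L a)

boundedCodeWeight : ∀ {k a N} → BoundedCode k a N → ℕ
boundedCodeWeight (L , _ , xs , m) = L + (gapWeight 0 xs + markWeight 0 m)

Fiber-BoundedCode↔ : ∀ k a {N n} → n < N → Fiber (boundedCodeWeight {k} {a} {N}) n ↔ Fiber (codeWeight {k} {a}) n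
Fiber-BoundedCode↔ k a {N} {n} n<N = mk↔ₛ′ to from (λ _ → refl) from∘to
  where
  to : Fiber boundedCodeWeight n → Fiber codeWeight n
  to ((L , _ , d) , p) = (L , d) , p
  from : Fiber codeWeight n → Fiber boundedCodeWeight n
  from ((L , d) , p) = (L , ℕₚ.≤-<-trans (subst (L ≤_) p (ℕₚ.m≤m+n L _)) n<N , d) , p
  from∘to : ∀ z → from (to z) ≡ z
  from∘to ((L , _ , d) , p) = cong (λ L<N → (L , L<N , d) , p) (ℕₚ.<-irrelevant _ _)

-- Overpartitions as gap vectors with markings

-- The least value a part placed directly above π may take.
minNext : List Part → ℕ
minNext []            = 1
minNext ((p , o) ∷ _) = if o then suc p else p

stack : ℕ → Bool → List Part → List Part
stack x o π = (x + minNext π , o) ∷ π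

minNext-positive : ∀ π → T (isOverpartition π) → 1 ≤ minNext π
minNext-positive []                _ = s≤s z≤n
minNext-positive ((p , true)  ∷ π) _ = s≤s z≤n
minNext-positive ((p , false) ∷ π) v = ℕₚ.≤ᵇ⇒≤ 1 p (proj₁ (T-∧⁻ (1 ≤ᵇ p) v))

isOverpartition-∷⁻ : ∀ p o π → T (isOverpartition ((p , o) ∷ π)) → minNext π ≤ p × T (isOverpartition π)
isOverpartition-∷⁻ p o π v = above π (proj₁ (T-∧⁻ (nextOK p π) rest)) , proj₂ (T-∧⁻ (nextOK p π) rest)
  where
  1≤p : T (1 ≤ᵇ p)
  1≤p = proj₁ (T-∧⁻ (1 ≤ᵇ p) v)
  rest : T (nextOK p π ∧ isOverpartition π)
  rest = proj₂ (T-∧⁻ (1 ≤ᵇ p) v)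
  above : ∀ π → T (nextOK p π) → minNext π ≤ p
  above []                _  = ℕₚ.≤ᵇ⇒≤ 1 p 1≤p
  above ((b , true)  ∷ _) ok = ℕₚ.<ᵇ⇒< b p (proj₂ (T-∧⁻ (b ≤ᵇ p) ok))
  above ((b , false) ∷ _) ok = ℕₚ.≤ᵇ⇒≤ b p (proj₁ (T-∧⁻ (b ≤ᵇ p) ok))

isOverpartition-∷⁺ : ∀ p o π → minNext π ≤ p → T (isOverpartition π) → T (isOverpartition ((p , o) ∷ π))
isOverpartition-∷⁺ p o π π≤p v =
  T-∧⁺ (ℕₚ.≤⇒≤ᵇ (ℕₚ.≤-trans (minNext-positive π v) π≤p)) (T-∧⁺ (nextOK-minNext π π≤p) v)
  where
  nextOK-minNext : ∀ π → minNext π ≤ p → T (nextOK p π)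
  nextOK-minNext []                _   = tt
  nextOK-minNext ((b , true)  ∷ _) b<p = T-∧⁺ (ℕₚ.≤⇒≤ᵇ (ℕₚ.<⇒≤ b<p)) (ℕₚ.<⇒<ᵇ b<p)
  nextOK-minNext ((b , false) ∷ _) b≤p = T-∧⁺ (ℕₚ.≤⇒≤ᵇ b≤p) tt

decode : ∀ {k L a} → Vec ℕ L → Marking k L a → List Part
decode []       []         = []
decode (x ∷ xs) (skip m)   = stack x false (decode xs m)
decode (x ∷ xs) (mark _ m) = stack x true  (decode xs m)

decodeCode : ∀ {k a} → Code k a → List Part
decodeCode (_ , xs , m) = decode xs m

length-decode : ∀ {k L a} (xs : Vec ℕ L) (m : Marking k L a) → length (decode xs m) ≡ L
length-decode []       []         = refl
length-decode (x ∷ xs) (skip m)   = cong suc (length-decode xs m)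
length-decode (x ∷ xs) (mark _ m) = cong suc (length-decode xs m)

numOverlined-decode : ∀ {k L a} (xs : Vec ℕ L) (m : Marking k L a) → numOverlined (decode xs m) ≡ a
numOverlined-decode []       []         = refl
numOverlined-decode (x ∷ xs) (skip m)   = numOverlined-decode xs m
numOverlined-decode (x ∷ xs) (mark _ m) = cong suc (numOverlined-decode xs m)

isOverpartition-decode : ∀ {k L a} (xs : Vec ℕ L) (m : Marking k L a) → T (isOverpartition (decode xs m))
isOverpartition-decode []       []         = tt
isOverpartition-decode (x ∷ xs) (skip m)   =
  isOverpartition-∷⁺ _ false (decode xs m) (ℕₚ.m≤n+m _ x) (isOverpartition-decode xs m)
isOverpartition-decode (x ∷ xs) (mark _ m) =
  isOverpartition-∷⁺ _ true (decode xs m) (ℕₚ.m≤n+m _ x) (isOverpartition-decode xs m)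

fkCond-decode : ∀ {k L a} (xs : Vec ℕ L) (m : Marking k L a) → T (fkCond k (decode xs m))
fkCond-decode []       []          = tt
fkCond-decode (x ∷ xs) (skip m)    = fkCond-decode xs m
fkCond-decode {k} (x ∷ xs) (mark k∣ m) =
  T-∧⁺ (subst (λ L → T ⌊ k ∣? suc L ⌋) (sym (length-decode xs m)) k∣) (fkCond-decode xs m)

-- t · minNext π is what π contributes to the t parts stacked above it.
size-stack : ∀ t x o π →
  size (stack x o π) + t * minNext (stack x o π) ≡ suc t * x + (if o then t else 0) + (size π + suc t * minNext π)
size-stack t x true  π = solve t x (size π) (minNext π)
  where
  solve : ∀ t x s h → (x + h) + s + t * suc (x + h) ≡ suc t * x + t + (s + suc t * h)
  solve = ℕ-Solver.solve-∀
size-stack t x false π = solve t x (size π) (minNext π)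
  where
  solve : ∀ t x s h → (x + h) + s + t * (x + h) ≡ suc t * x + 0 + (s + suc t * h)
  solve = ℕ-Solver.solve-∀

size-decode-shifted : ∀ {k L a} t (xs : Vec ℕ L) (m : Marking k L a) →
  size (decode xs m) + t * minNext (decode xs m) ≡ t + (L + (gapWeight t xs + markWeight t m))
size-decode-shifted t []       []         = solve t
  where
  solve : ∀ t → 0 + t * 1 ≡ t + (0 + (0 + 0))
  solve = ℕ-Solver.solve-∀
size-decode-shifted {L = suc L} t (x ∷ xs) (skip m) =
  trans (size-stack t x false (decode xs m))
        (trans (cong (_+_ (suc t * x + 0)) (size-decode-shifted (suc t) xs m))
               (solve t x L (gapWeight (suc t) xs) (markWeight (suc t) m)))
  where
  solve : ∀ t x L G M → suc t * x + 0 + (suc t + (L + (G + M))) ≡ t + (suc L + ((suc t * x + G) + M))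
  solve = ℕ-Solver.solve-∀
size-decode-shifted {L = suc L} t (x ∷ xs) (mark _ m) =
  trans (size-stack t x true (decode xs m))
        (trans (cong (_+_ (suc t * x + t)) (size-decode-shifted (suc t) xs m))
               (solve t x L (gapWeight (suc t) xs) (markWeight (suc t) m)))
  where
  solve : ∀ t x L G M → suc t * x + t + (suc t + (L + (G + M))) ≡ t + (suc L + ((suc t * x + G) + (t + M)))
  solve = ℕ-Solver.solve-∀

size-decode : ∀ {k a} (d : Code k a) → size (decodeCode d) ≡ codeWeight d
size-decode (L , xs , m) = trans (sym (ℕₚ.+-identityʳ _)) (size-decode-shifted 0 xs m)

gaps : (π : List Part) → Vec ℕ (length π)
gaps []            = []
gaps ((p , _) ∷ π) = p ∸ minNext π ∷ gaps π

marks : ∀ k (π : List Part) → T (fkCond k π) → Marking k (length π) (numOverlined π)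
marks k []                _ = []
marks k ((_ , false) ∷ π) v = skip (marks k π v)
marks k ((_ , true)  ∷ π) v = mark k∣ (marks k π v′)
  where
  k∣ : T ⌊ k ∣? suc (length π) ⌋
  k∣ = proj₁ (T-∧⁻ ⌊ k ∣? suc (length π) ⌋ v)
  v′ : T (fkCond k π)
  v′ = proj₂ (T-∧⁻ ⌊ k ∣? suc (length π) ⌋ v)

encode : ∀ k {a} (π : List Part) → T (fkCond k π) → numOverlined π ≡ a → Code k a
encode k π v c = length π , gaps π , subst (Marking k (length π)) c (marks k π v)

stack-∸ : ∀ p o π → minNext π ≤ p → stack (p ∸ minNext π) o π ≡ (p , o) ∷ π
stack-∸ p o π π≤p = cong (λ q → (q , o) ∷ π) (ℕₚ.m∸n+n≡m π≤p)

decode-gaps-marks : ∀ k π v → T (isOverpartition π) → decode (gaps π) (marks k π v) ≡ π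
decode-gaps-marks k []            _ _ = refl
decode-gaps-marks k ((p , o) ∷ π) v op with isOverpartition-∷⁻ p o π op
decode-gaps-marks k ((p , false) ∷ π) v op | π≤p , opπ =
  trans (cong (stack (p ∸ minNext π) false) (decode-gaps-marks k π v opπ)) (stack-∸ p false π π≤p)
decode-gaps-marks k ((p , true)  ∷ π) v op | π≤p , opπ =
  trans (cong (stack (p ∸ minNext π) true) (decode-gaps-marks k π _ opπ)) (stack-∸ p true π π≤p)

decode-encode : ∀ k {a} π v (c : numOverlined π ≡ a) → T (isOverpartition π) → decodeCode (encode k π v c) ≡ π
decode-encode k π v refl = decode-gaps-marks k π v

consSkip : ∀ {k a} → ℕ → Code k a → Code k a
consSkip x (L , xs , m) = suc L , x ∷ xs , skip m

consMark : ∀ {k a} → ℕ → (d : Code k a) → T ⌊ k ∣? suc (proj₁ d) ⌋ → Code k (suc a)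
consMark x (L , xs , m) k∣ = suc L , x ∷ xs , mark k∣ m

consMark-cong : ∀ {k a x x′} {d d′ : Code k a} {k∣ k∣′} → x ≡ x′ → d ≡ d′ →
  consMark x d k∣ ≡ consMark x′ d′ k∣′
consMark-cong {x = x} {d = d} refl refl = cong (consMark x d) (T-irrelevant _ _)

encode-false : ∀ k {a} p π v (c : numOverlined π ≡ a) →
  encode k ((p , false) ∷ π) v c ≡ consSkip (p ∸ minNext π) (encode k π v c)
encode-false k p π v refl = refl

encode-true : ∀ k {a} p π v (c : suc (numOverlined π) ≡ suc a) →
  encode k ((p , true) ∷ π) v c
    ≡ consMark (p ∸ minNext π) (encode k π (proj₂ (T-∧⁻ ⌊ k ∣? suc (length π) ⌋ v)) (ℕₚ.suc-injective c))
               (proj₁ (T-∧⁻ ⌊ k ∣? suc (length π) ⌋ v))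
encode-true k p π v refl = refl

encode-decode : ∀ {k L a} (xs : Vec ℕ L) (m : Marking k L a) v c → encode k (decode xs m) v c ≡ (L , xs , m)
encode-decode {k} []       []         v c = cong (λ c → 0 , [] , subst (Marking k 0) c []) (ℕₚ.≡-irrelevant c refl)
encode-decode {k} (x ∷ xs) (skip m)   v c = trans (encode-false k _ (decode xs m) v c)
  (cong₂ consSkip (ℕₚ.m+n∸n≡m x (minNext (decode xs m))) (encode-decode xs m v c))
encode-decode {k} (x ∷ xs) (mark _ m) v c = trans (encode-true k _ (decode xs m) v c)
  (consMark-cong (ℕₚ.m+n∸n≡m x (minNext (decode xs m))) (encode-decode xs m _ _))

FkOver↔Fiber : ∀ k n a → FkOver k n a ↔ Fiber (codeWeight {k} {a}) n
FkOver↔Fiber k n a = mk↔ₛ′ to from to∘from from∘to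
  where
  to : FkOver k n a → Fiber codeWeight n
  to (π , v , s , c) = d , trans (sym (size-decode d)) (trans (cong size (decode-encode k π fk c op)) s)
    where
    op : T (isOverpartition π)
    op = proj₁ (T-∧⁻ (isOverpartition π) v)
    fk : T (fkCond k π)
    fk = proj₂ (T-∧⁻ (isOverpartition π) v)
    d : Code k a
    d = encode k π fk c
  from : Fiber codeWeight n → FkOver k n a
  from (d@(L , xs , m) , w) = decode xs m , T-∧⁺ (isOverpartition-decode xs m) (fkCond-decode xs m) ,
                              trans (size-decode d) w , numOverlined-decode xs m
  to∘from : ∀ y → to (from y) ≡ y
  to∘from ((L , xs , m) , w) = Σ-≡-irrelevant (λ _ → ℕₚ.≡-irrelevant) (encode-decode xs m _ _)
  from∘to : ∀ x → from (to x) ≡ x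
  from∘to (π , v , s , c) = Σ-≡-irrelevant FkOver-irrelevant
    (decode-encode k π (proj₂ (T-∧⁻ (isOverpartition π) v)) c (proj₁ (T-∧⁻ (isOverpartition π) v)))
    where
    FkOver-irrelevant : ∀ π → Irrelevant (T (isFkOverpartition k π) × size π ≡ n × numOverlined π ≡ a)
    FkOver-irrelevant π (v , s , c) (v′ , s′ , c′) =
      cong₂ _,_ (T-irrelevant v v′) (cong₂ _,_ (ℕₚ.≡-irrelevant s s′) (ℕₚ.≡-irrelevant c c′))

card-rhsPartial : ∀ k a {n M} → n ≤ M → Card (rhsPartial (suc k) M a n) (FkOver (suc k) n a)
card-rhsPartial k a {n} {M} n≤M = Card-≡ (sym (rhsPartial≡σ-layer k M a n))
  (Card-↔ (IsGF-σ (suc (suc k * M)) (IsGF-layer (suc k) a) n)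
          (↔-trans (Fiber-BoundedCode↔ (suc k) a n<N) (↔-sym (FkOver↔Fiber (suc k) n a))))
  where
  n<N : n < suc (suc k * M)
  n<N = s≤s (ℕₚ.≤-trans n≤M (ℕₚ.m≤n*m M (suc k)))

mainTheorem5 : (k : ℕ) → 1 ≤ k → (a n : ℕ) →
    Σ ℕ (λ c → (Fin c ↔ FkOver k n a) ×
      ∃[ N ] ((M : ℕ) → N ≤ M → rhsPartial k M a n ≡ + c))
mainTheorem5 (suc k) _ a n =
  let c , _ , Fin↔FkOver = card-rhsPartial k a (ℕₚ.≤-refl {n}) in
  c , Fin↔FkOver , n , λ M n≤M → Card-unique (card-rhsPartial k a n≤M) (c , refl , Fin↔FkOver)
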